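{- The determinant of the square matrix over $\mathbb Z/2$ represented by a finite directed graph is definable in FP+Card. That is, there is an FP+Card sentence which holds in a finite directed graph $\langle I,E\rangle$ (with $E\subseteq I\times I$, loops allowed) exactly when the $I$-square matrix $M$ over $\mathbb Z/2$ with $M(i,j)=1\iff (i,j)\in E$ has determinant $1$.
   Context: For a finite set $I$, an $I$-square matrix is a function $M:I\times I\to\mathbb Z/2$; its determinant is that of the ordinary matrix obtained by choosing any linear ordering of $I$ for both rows and columns, and is independent of the ordering. Truth values are identified with the possible determinant values $0,1$. FP+Card: each input structure with universe $A$ is extended to a two-sorted structure whose second sort is $\{0,\dots,|A|\}$ with successor; formulas are first-order formulas extended by the inflationary fixpoint operator (on either or both sorts) and counting terms $(\sharp x)\varphi(x)$ giving the number of $x$ satisfying $\varphi$. -}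

module Defs where

open import Data.Nat using (ℕ; zero; suc; _*_)
open import Data.Fin using (Fin; zero; suc; inject₁; punchIn; _≟_)
open import Data.Bool using (Bool; true; false; _∧_; _∨_; not; _xor_; if_then_else_)
open import Data.List using (List; []; _∷_; _++_)
open import Data.Product using (_×_; _,_)
open import Data.Unit using (⊤; tt)
open import Relation.Nullary.Decidable using (⌊_⌋)

-- Determinant over ℤ/2 (ℤ/2 represented by Bool: false = 0, true = 1,
-- addition = xor, multiplication = ∧).  Defined by cofactor (Laplace)
-- expansion along the first row; over ℤ/2 every sign (-1)^j equals 1.

detZ2 : (n : ℕ) → (Fin n → Fin n → Bool) → Bool
detZ2 zero M = true
detZ2 (suc n) M = go (suc n) (λ j → j)
  where
  go : (k : ℕ) → (Fin k → Fin (suc n)) → Bool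
  go zero f = false
  go (suc k) f =
    (M zero (f zero) ∧ detZ2 n (λ i l → M (suc i) (punchIn (f zero) l)))
    xor go k (λ j → f (suc j))

-- FP+Card over the vocabulary of directed graphs {E} (E binary).
-- Two sorts: vertices (universe Fin n) and numbers ({0,…,n} = Fin (suc n))
-- with the successor relation.

data Sort : Set where
  vtx num : Sort

El : ℕ → Sort → Set
El n vtx = Fin n
El n num = Fin (suc n)

card : ℕ → Sort → ℕ
card n vtx = n
card n num = suc n

eqEl : (n : ℕ) (s : Sort) → El n s → El n s → Bool
eqEl n vtx a b = ⌊ a ≟ b ⌋
eqEl n num a b = ⌊ a ≟ b ⌋

Tup : ℕ → List Sort → Set
Tup n []       = ⊤
Tup n (s ∷ ss) = El n s × Tup n ss

size : ℕ → List Sort → ℕ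
size n []       = 1
size n (s ∷ ss) = card n s * size n ss

appendTup : (n : ℕ) (as bs : List Sort) → Tup n as → Tup n bs → Tup n (as ++ bs)
appendTup n []       bs tt       ys = ys
appendTup n (a ∷ as) bs (x , xs) ys = x , appendTup n as bs xs ys

data Var : List Sort → Sort → Set where
  here  : ∀ {Γ s} → Var (s ∷ Γ) s
  there : ∀ {Γ s t} → Var Γ s → Var (t ∷ Γ) s

data RVar : List (List Sort) → List Sort → Set where
  here  : ∀ {Δ a} → RVar (a ∷ Δ) a
  there : ∀ {Δ a b} → RVar Δ a → RVar (b ∷ Δ) a

mutual
  -- terms: variables, and counting terms (♯x)φ(x) (x a vertex variable),
  -- which are of number sort
  data Term (Γ : List Sort) (Δ : List (List Sort)) : Sort → Set where
    var   : ∀ {s} → Var Γ s → Term Γ Δ s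
    count : Formula (vtx ∷ Γ) Δ → Term Γ Δ num

  data Terms (Γ : List Sort) (Δ : List (List Sort)) : List Sort → Set where
    []  : Terms Γ Δ []
    _∷_ : ∀ {s ss} → Term Γ Δ s → Terms Γ Δ ss → Terms Γ Δ (s ∷ ss)

  data Formula (Γ : List Sort) (Δ : List (List Sort)) : Set where
    E     : Term Γ Δ vtx → Term Γ Δ vtx → Formula Γ Δ
    eq    : ∀ {s} → Term Γ Δ s → Term Γ Δ s → Formula Γ Δ
    succ  : Term Γ Δ num → Term Γ Δ num → Formula Γ Δ   -- second = first + 1
    rel   : ∀ {a} → RVar Δ a → Terms Γ Δ a → Formula Γ Δ
    neg   : Formula Γ Δ → Formula Γ Δ
    and   : Formula Γ Δ → Formula Γ Δ → Formula Γ Δ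
    ex    : (s : Sort) → Formula (s ∷ Γ) Δ → Formula Γ Δ
    -- [ifp_{R, x̄} φ](t̄) : φ may use R and the new variables x̄ (sorts a)
    ifp   : (a : List Sort) → Formula (a ++ Γ) (a ∷ Δ) → Terms Γ Δ a → Formula Γ Δ

REnv : ℕ → List (List Sort) → Set
REnv n []      = ⊤
REnv n (a ∷ Δ) = (Tup n a → Bool) × REnv n Δ

lookupVar : ∀ {n Γ s} → Tup n Γ → Var Γ s → El n s
lookupVar (x , _)  here      = x
lookupVar (_ , xs) (there v) = lookupVar xs v

lookupRVar : ∀ {n Δ a} → REnv n Δ → RVar Δ a → (Tup n a → Bool)
lookupRVar (r , _)  here      = r
lookupRVar (_ , rs) (there v) = lookupRVar rs v

countFin : (k : ℕ) → (Fin k → Bool) → Fin (suc k)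
countFin zero    p = zero
countFin (suc k) p =
  if p zero then suc (countFin k (λ i → p (suc i)))
            else inject₁ (countFin k (λ i → p (suc i)))

anyEl : (n : ℕ) (s : Sort) → (El n s → Bool) → Bool
anyEl n vtx p = anyFin n p
  where
  anyFin : (k : ℕ) → (Fin k → Bool) → Bool
  anyFin zero    q = false
  anyFin (suc k) q = q zero ∨ anyFin k (λ i → q (suc i))
anyEl n num p = anyFin (suc n) p
  where
  anyFin : (k : ℕ) → (Fin k → Bool) → Bool
  anyFin zero    q = false
  anyFin (suc k) q = q zero ∨ anyFin k (λ i → q (suc i))

isSucc : (n : ℕ) → Fin (suc n) → Fin (suc n) → Bool
isSucc n a b = ⌊ suc a ≟ inject₁ b ⌋

module Semantics (n : ℕ) (G : Fin n → Fin n → Bool) where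

  mutual
    evalTerm : ∀ {Γ Δ s} → Term Γ Δ s → Tup n Γ → REnv n Δ → El n s
    evalTerm (var v)   ρ σ = lookupVar ρ v
    evalTerm (count φ) ρ σ = countFin n (λ x → eval φ (x , ρ) σ)

    evalTerms : ∀ {Γ Δ a} → Terms Γ Δ a → Tup n Γ → REnv n Δ → Tup n a
    evalTerms []       ρ σ = tt
    evalTerms (t ∷ ts) ρ σ = evalTerm t ρ σ , evalTerms ts ρ σ

    stage : ∀ {Γ Δ} (a : List Sort) → Formula (a ++ Γ) (a ∷ Δ) →
            Tup n Γ → REnv n Δ → ℕ → Tup n a → Bool
    stage a φ ρ σ zero    x̄ = false
    stage a φ ρ σ (suc k) x̄ =
      stage a φ ρ σ k x̄ ∨ eval φ (appendTup n a _ x̄ ρ) (stage a φ ρ σ k , σ)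

    eval : ∀ {Γ Δ} → Formula Γ Δ → Tup n Γ → REnv n Δ → Bool
    eval (E s t)      ρ σ = G (evalTerm s ρ σ) (evalTerm t ρ σ)
    eval (eq {s} t u) ρ σ = eqEl n s (evalTerm t ρ σ) (evalTerm u ρ σ)
    eval (succ t u)   ρ σ = isSucc n (evalTerm t ρ σ) (evalTerm u ρ σ)
    eval (rel R ts)   ρ σ = lookupRVar σ R (evalTerms ts ρ σ)
    eval (neg φ)      ρ σ = not (eval φ ρ σ)
    eval (and φ ψ)    ρ σ = eval φ ρ σ ∧ eval ψ ρ σ
    eval (ex s φ)     ρ σ = anyEl n s (λ x → eval φ (x , ρ) σ)
    -- the stages increase, and there are only `size n a` tuples, so stage
    -- number `size n a` is the inflationary fixpoint
    eval (ifp a φ ts) ρ σ = stage a φ ρ σ (size n a) (evalTerms ts ρ σ)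

Sentence : Set
Sentence = Formula [] []

holds : Sentence → (n : ℕ) → (Fin n → Fin n → Bool) → Bool
holds φ n G = Semantics.eval n G φ tt tt

-- Over ℤ/2, det G = 1 iff G is injective.  G is injective iff, for every vertex v,
-- the Krylov vectors e_v, G e_v, …, Gⁿ e_v satisfy a linear relation with
-- constant term 1 (then e_v lies in the image of G, and conversely a relation
-- among these n + 1 vectors can be divided by G until its constant term is 1).
-- The unknowns of this linear system are indexed by the ordered number sort
-- 0 … n, so Gaussian elimination along the columns 1 … n decides it; no order on
-- the rows (vertices) is needed, since the pivot for column k can be taken to be
-- the lexicographically least row with a 1 in column k, which is definable.
-- Matrix powers, pivot candidates and the successive eliminated systems are
-- iterations indexed by the number sort, realised by inflationary fixpoints, and
-- sums over ℤ/2 are parities of counting terms.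
{-# OPTIONS --safe #-}
module Submission where

open import Defs
open import Algebra.Bundles using (CommutativeRing)
import Algebra.Properties.CommutativeSemigroup
import Data.Bool as Bool
open import Data.Bool using (Bool; true; false; not; _∧_; _∨_; _xor_)
open import Data.Bool.Properties
  using (xor-∧-commutativeRing; xor-same; xor-identityʳ; xor-comm; ∧-zeroʳ; ∧-identityʳ; ∧-assoc; ∧-distribˡ-xor;
        ∧-distribʳ-xor; ∨-zeroʳ; ∨-identityʳ; ∨-idem; T-≡; not-involutive; ¬-not; ∧-conicalˡ; ∧-conicalʳ)
open import Data.Fin using (Fin; zero; suc; punchIn; punchOut; _≟_; toℕ; fromℕ; inject₁)
open import Data.Fin.Properties
  using (toℕ-fromℕ; toℕ-inject₁; toℕ≤pred[n]; toℕ<n; punchInᵢ≢i; punchIn-punchOut; punchOut-punchIn;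
        punchOut-cong; punchOut-injective)
open import Data.Nat using (ℕ; zero; suc; _+_; _*_; _<ᵇ_; NonZero; _<_; _≤_; s≤s; z≤n; s≤s⁻¹)
open import Data.Nat.Properties
  using (1+n≢n; <⇒<ᵇ; m≤m*n; m*n≢0; m≤n⇒m≤1+n; ≤-refl; ≤-trans; <⇒≤; suc-injective; m≤n⇒m<n∨m≡n; +-identityʳ;
        +-suc; m<m+n; n≮n)
open import Data.List using (List; []; _∷_; _++_)
open import Data.Unit using (tt)
open import Data.Product using (Σ; ∃; _×_; _,_; proj₁; proj₂)
open import Data.Sum using (_⊎_; inj₁; inj₂; [_,_]′)
open import Data.Vec.Functional using (Vector; foldr; map; insertAt; updateAt)
open import Data.Vec.Functional.Properties using (insertAt-lookup; insertAt-punchIn; updateAt-updates; updateAt-minimal)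
open import Data.Fin.Permutation using (Permutation′; _⟨$⟩ʳ_; remove; transpose; punchIn-permute)
import Data.Fin.Permutation.Components as PC
open import Function.Base using (_∘_; _∋_; it)
open import Function.Bundles using (_⇔_; mk⇔; Equivalence)
open import Relation.Binary.PropositionalEquality
  using (_≡_; _≢_; refl; sym; trans; cong; cong₂; subst; module ≡-Reasoning)
open import Relation.Nullary using (yes; no; contradiction)
open import Relation.Nullary.Decidable using (⌊_⌋; dec-true; dec-false; isYes≗does; toWitness)

private
  variable
    m n : ℕ

-- Sums and disjunctions over finite index sets

module ℤ₂ = CommutativeRing xor-∧-commutativeRing

open import Algebra.Properties.Semiring.Sum ℤ₂.semiring
  using (sum; sum-cong-≗; sum-replicate-zero; sum-remove; ∑-distrib-+; ∑-comm; sum-permute; *-distribˡ-sum; *-distribʳ-sum; sum-init-last)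

module ∧-Props = Algebra.Properties.CommutativeSemigroup ℤ₂.*-commutativeSemigroup

xor≡false⇒≡ : ∀ a b → a xor b ≡ false → a ≡ b
xor≡false⇒≡ false b    b≡0 = sym b≡0
xor≡false⇒≡ true  true _   = refl

≟-true : {i j : Fin n} → i ≡ j → ⌊ i ≟ j ⌋ ≡ true
≟-true {i = i} {j} i≡j = trans (isYes≗does (i ≟ j)) (dec-true (i ≟ j) i≡j)

≟-false : {i j : Fin n} → i ≢ j → ⌊ i ≟ j ⌋ ≡ false
≟-false {i = i} {j} i≢j = trans (isYes≗does (i ≟ j)) (dec-false (i ≟ j) i≢j)

IsZero : Vector Bool n → Set
IsZero x = ∀ i → x i ≡ false

IsNonzero : Vector Bool n → Set
IsNonzero x = ∃ λ i → x i ≡ true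

infixl 6 _+ᵥ_
_+ᵥ_ : Vector Bool n → Vector Bool n → Vector Bool n
(x +ᵥ y) i = x i xor y i

infix 8 _·_
_·_ : Vector Bool n → Vector Bool n → Bool
x · y = sum (λ j → x j ∧ y j)

sum-zero : {f : Vector Bool n} → (∀ i → f i ≡ false) → sum f ≡ false
sum-zero {n} f≡0 = trans (sum-cong-≗ f≡0) (sum-replicate-zero n)

sum-single : (f : Vector Bool n) (i : Fin n) → (∀ j → j ≢ i → f j ≡ false) → sum f ≡ f i
sum-single {suc n} f i others = begin
  sum f                       ≡⟨ sum-remove f ⟩
  f i xor sum (f ∘ punchIn i) ≡⟨ cong (f i xor_) (sum-zero (λ j → others (punchIn i j) (punchInᵢ≢i i j))) ⟩
  f i xor false               ≡⟨ xor-identityʳ (f i) ⟩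
  f i                         ∎
  where open ≡-Reasoning

sum-pair : (f : Vector Bool n) {a b : Fin n} (a≢b : a ≢ b) →
           (∀ j → j ≢ a → j ≢ b → f j ≡ false) → sum f ≡ f a xor f b
sum-pair {suc n} f {a} {b} a≢b others = begin
  sum f                                ≡⟨ sum-remove f ⟩
  f a xor sum (f ∘ punchIn a)          ≡⟨ cong (f a xor_) (sum-single (f ∘ punchIn a) (punchOut a≢b) others′) ⟩
  f a xor f (punchIn a (punchOut a≢b)) ≡⟨ cong (λ j → f a xor f j) (punchIn-punchOut a≢b) ⟩
  f a xor f b                          ∎
  where
  open ≡-Reasoning
  others′ : ∀ j → j ≢ punchOut a≢b → f (punchIn a j) ≡ false
  others′ j j≢b′ = others (punchIn a j) (punchInᵢ≢i a j)
    (λ aj≡b → j≢b′ (trans (sym (punchOut-punchIn a)) (punchOut-cong a aj≡b)))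

or : Vector Bool n → Bool
or = foldr _∨_ false

or-true : (x : Vector Bool n) (i : Fin n) → x i ≡ true → or x ≡ true
or-true {suc n} x zero    xᵢ = cong (_∨ or (x ∘ suc)) xᵢ
or-true {suc n} x (suc i) xᵢ = trans (cong (x zero ∨_) (or-true (x ∘ suc) i xᵢ)) (∨-zeroʳ (x zero))

or-false : {x : Vector Bool n} → IsZero x → or x ≡ false
or-false {zero}  x≡0 = refl
or-false {suc n} x≡0 = cong₂ _∨_ (x≡0 zero) (or-false (x≡0 ∘ suc))

or-false⁻¹ : (x : Vector Bool n) → or x ≡ false → IsZero x
or-false⁻¹ x ∨x≡0 i with x i in xᵢ
... | false = refl
... | true  = trans (sym (or-true x i xᵢ)) ∨x≡0

or-cong : {x y : Vector Bool n} → (∀ i → x i ≡ y i) → or x ≡ or y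
or-cong {zero}  x≡y = refl
or-cong {suc n} x≡y = cong₂ _∨_ (x≡y zero) (or-cong (x≡y ∘ suc))

or-single : (x : Vector Bool n) (i : Fin n) → (∀ j → j ≢ i → x j ≡ false) → or x ≡ x i
or-single x i others with x i in xᵢ
... | true  = or-true x i xᵢ
... | false = or-false xⱼ≡0
  where
  xⱼ≡0 : IsZero x
  xⱼ≡0 j with j ≟ i
  ... | yes refl = xᵢ
  ... | no  j≢i  = others j j≢i

search : (x : Vector Bool n) → IsNonzero x ⊎ IsZero x
search {zero}  x = inj₂ (λ ())
search {suc n} x with x zero in x₀ | search (x ∘ suc)
... | true  | _              = inj₁ (zero , x₀)
... | false | inj₁ (i , xᵢ)  = inj₁ (suc i , xᵢ)
... | false | inj₂ x′≡0      = inj₂ λ { zero → x₀ ; (suc i) → x′≡0 i }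

not-or-or≡true⇔ : (f : Fin m → Fin n → Bool) → not (or λ v → or (f v)) ≡ true ⇔ (∀ v w → f v w ≡ false)
not-or-or≡true⇔ f = mk⇔
  (λ ¬∨∨f v → or-false⁻¹ (f v) (or-false⁻¹ (λ v → or (f v)) (trans (sym (not-involutive _)) (cong not ¬∨∨f)) v))
  (λ f≡0 → cong not (or-false (λ v → or-false (f≡0 v))))

≡-via-⇔ : ∀ {x y : Bool} {P : Set} → x ≡ true ⇔ P → y ≡ true ⇔ P → x ≡ y
≡-via-⇔ {true}  {true}  x⇔P y⇔P = refl
≡-via-⇔ {false} {false} x⇔P y⇔P = refl
≡-via-⇔ {true}  {false} x⇔P y⇔P = sym (Equivalence.from y⇔P (Equivalence.to x⇔P refl))
≡-via-⇔ {false} {true}  x⇔P y⇔P = Equivalence.from x⇔P (Equivalence.to y⇔P refl)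

-- `detZ2` and `anyEl` recurse through local `where` functions of Defs, which
-- cannot be named here; they are identified with `foldr` by their recursion
-- equations.  At each use, `with` first abstracts the hidden parameters of the
-- local function, then introduces this lemma (so that unification can solve `g`),
-- and only then abstracts the arguments the local function is applied to.
foldr-unique : {A B C : Set} (_⊕_ : B → C → C) (e : C) (t : A → B) {g : ∀ k → (Fin k → A) → C} →
               (∀ f → g 0 f ≡ e) → (∀ k f → g (suc k) f ≡ t (f zero) ⊕ g k (f ∘ suc)) →
               ∀ k f → g k f ≡ foldr _⊕_ e (map t f)
foldr-unique _⊕_ e t     g0 gs zero    f = g0 f
foldr-unique _⊕_ e t {g} g0 gs (suc k) f =
  trans (gs k f) (cong (t (f zero) ⊕_) (foldr-unique _⊕_ e t {g} g0 gs k (f ∘ suc)))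

-- Linear algebra over ℤ/2

Equations : ℕ → ℕ → Set
Equations m n = Fin m → Vector Bool (suc n)

Solvable : Equations m n → Set
Solvable r = ∃ λ c → c zero ≡ true × ∀ w → r w · c ≡ false

combination : ∀ {m d} → (Fin m → Vector Bool d) → Vector Bool m → Vector Bool d
combination u S r = (λ i → u i r) · S

Dependent : ∀ {m d} → (Fin m → Vector Bool d) → Set
Dependent u = ∃ λ S → IsNonzero S × IsZero (combination u S)

dependent : ∀ {d m} → d < m → (u : Fin m → Vector Bool d) → Dependent u
dependent {zero}  {suc m} _ u = (λ _ → true) , (zero , refl) , (λ ())
dependent {suc d} {suc m} (s≤s d<m) u with search (λ i → u i zero)
... | inj₂ column₀≡0 =
  let S , S≢0 , uS≡0 = dependent (m≤n⇒m≤1+n d<m) (λ i → u i ∘ suc) in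
  S , S≢0 , λ { zero → sum-zero (λ i → cong (_∧ S i) (column₀≡0 i)) ; (suc r) → uS≡0 r }
... | inj₁ (i₀ , u₀≡1) =
  let S′ , (j , S′ⱼ) , u′S′≡0 = dependent d<m u′ in
  insertAt S′ i₀ (α S′) , (punchIn i₀ j , trans (insertAt-punchIn S′ i₀ _ j) S′ⱼ) , zeroAt S′ u′S′≡0
  where
  -- Clear coordinate 0 by adding u i₀ where it is 1, then drop u i₀ and coordinate 0.
  u′ : Fin m → Vector Bool d
  u′ j r = u (punchIn i₀ j) (suc r) xor (u (punchIn i₀ j) zero ∧ u i₀ (suc r))
  α : Vector Bool m → Bool
  α S′ = combination (u ∘ punchIn i₀) S′ zero
  remove-i₀ : ∀ S′ r → combination u (insertAt S′ i₀ (α S′)) r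
                       ≡ (u i₀ r ∧ α S′) xor combination (u ∘ punchIn i₀) S′ r
  remove-i₀ S′ r = trans (sum-remove {i = i₀} (λ i → u i r ∧ insertAt S′ i₀ (α S′) i))
    (cong₂ _xor_ (cong (u i₀ r ∧_) (insertAt-lookup S′ i₀ (α S′)))
                 (sum-cong-≗ (λ j → cong (u (punchIn i₀ j) r ∧_) (insertAt-punchIn S′ i₀ (α S′) j))))
  zeroAt : ∀ S′ → IsZero (combination u′ S′) → IsZero (combination u (insertAt S′ i₀ (α S′)))
  zeroAt S′ u′S′≡0 zero = begin
    _                          ≡⟨ remove-i₀ S′ zero ⟩
    (u i₀ zero ∧ α S′) xor α S′ ≡⟨ cong (λ b → (b ∧ α S′) xor α S′) u₀≡1 ⟩
    α S′ xor α S′              ≡⟨ xor-same (α S′) ⟩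
    false                      ∎
    where open ≡-Reasoning
  zeroAt S′ u′S′≡0 (suc r) = begin
    _                                 ≡⟨ remove-i₀ S′ (suc r) ⟩
    (c ∧ α S′) xor A                  ≡⟨ xor-comm _ A ⟩
    A xor (c ∧ α S′)                  ≡⟨ cong (A xor_) (*-distribˡ-sum c (λ j → u (punchIn i₀ j) zero ∧ S′ j)) ⟩
    A xor sum (λ j → c ∧ (u (punchIn i₀ j) zero ∧ S′ j))
                                      ≡⟨ ∑-distrib-+ (λ j → u (punchIn i₀ j) (suc r) ∧ S′ j) _ ⟨
    sum (λ j → u (punchIn i₀ j) (suc r) ∧ S′ j xor c ∧ (u (punchIn i₀ j) zero ∧ S′ j))
                                      ≡⟨ sum-cong-≗ (λ j → shuffle (u (punchIn i₀ j) (suc r)) (u (punchIn i₀ j) zero) (S′ j)) ⟨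
    combination u′ S′ r               ≡⟨ u′S′≡0 r ⟩
    false                             ∎
    where
    open ≡-Reasoning
    c = u i₀ (suc r)
    A = combination (u ∘ punchIn i₀) S′ (suc r)
    shuffle : ∀ a b s → (a xor b ∧ c) ∧ s ≡ a ∧ s xor c ∧ (b ∧ s)
    shuffle a b s = trans (∧-distribʳ-xor s a (b ∧ c)) (cong (a ∧ s xor_) (∧-Props.xy∙z≈y∙xz b c s))

Matrix : ℕ → Set
Matrix n = Fin n → Fin n → Bool

infixr 7 _*ᵥ_
_*ᵥ_ : Matrix n → Vector Bool n → Vector Bool n
(M *ᵥ y) i = M i · y

KernelTrivial : Matrix n → Set
KernelTrivial M = ∀ y → IsZero (M *ᵥ y) → IsZero y

*ᵥ-cong : (M : Matrix n) {x y : Vector Bool n} → (∀ j → x j ≡ y j) → ∀ i → (M *ᵥ x) i ≡ (M *ᵥ y) i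
*ᵥ-cong M x≡y i = sum-cong-≗ (λ j → cong (M i j ∧_) (x≡y j))

*ᵥ-zero : (M : Matrix n) → IsZero (M *ᵥ λ _ → false)
*ᵥ-zero M i = sum-zero (λ j → ∧-zeroʳ (M i j))

*ᵥ-+ᵥ : (M : Matrix n) (x y : Vector Bool n) → ∀ i → (M *ᵥ (x +ᵥ y)) i ≡ (M *ᵥ x) i xor (M *ᵥ y) i
*ᵥ-+ᵥ M x y i = trans (sum-cong-≗ (λ j → ∧-distribˡ-xor (M i j) (x j) (y j))) (∑-distrib-+ (λ j → M i j ∧ x j) (λ j → M i j ∧ y j))

*ᵥ-combination : ∀ {m} (M : Matrix n) (u : Fin m → Vector Bool n) S →
                 ∀ i → (M *ᵥ combination u S) i ≡ combination (λ l → M *ᵥ u l) S i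
*ᵥ-combination M u S i = begin
  sum (λ j → M i j ∧ sum (λ l → u l j ∧ S l))          ≡⟨ sum-cong-≗ (λ j → *-distribˡ-sum (M i j) (λ l → u l j ∧ S l)) ⟩
  sum (λ j → sum (λ l → M i j ∧ (u l j ∧ S l)))        ≡⟨ ∑-comm (λ j l → M i j ∧ (u l j ∧ S l)) ⟩
  sum (λ l → sum (λ j → M i j ∧ (u l j ∧ S l)))        ≡⟨ sum-cong-≗ (λ l → trans (sum-cong-≗ (λ j → sym (∧-assoc (M i j) (u l j) (S l))))
                                                                                 (sym (*-distribʳ-sum (S l) (λ j → M i j ∧ u l j)))) ⟩
  combination (λ l → M *ᵥ u l) S i                    ∎
  where open ≡-Reasoning

identity : Matrix n
identity w v = ⌊ w ≟ v ⌋

identity-*ᵥ : (x : Vector Bool n) → ∀ i → (identity *ᵥ x) i ≡ x i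
identity-*ᵥ x i = trans (sum-single (λ j → identity i j ∧ x j) i (λ j j≢i → cong (_∧ x j) (≟-false (j≢i ∘ sym))))
                        (cong (_∧ x i) (≟-true refl))

-- b and the n columns of M are dependent, and a relation not involving b would
-- contradict injectivity.
kernelTrivial⇒surjective : {M : Matrix n} → KernelTrivial M → ∀ b → ∃ λ x → ∀ i → (M *ᵥ x) i ≡ b i
kernelTrivial⇒surjective {n} {M} ker b with dependent ≤-refl (λ { zero → b ; (suc c) r → M r c })
... | T , (i , Tᵢ) , Tdep with T zero in T₀
...   | true  = T ∘ suc , λ r → sym (trans (sym (∧-identityʳ (b r))) (xor≡false⇒≡ _ _ (Tdep r)))
...   | false = contradiction Tᵢ (¬T i)
  where
  T′≡0 : IsZero (T ∘ suc)
  T′≡0 = ker (T ∘ suc) (λ r → trans (cong (λ z → z xor (M *ᵥ T ∘ suc) r) (sym (∧-zeroʳ (b r)))) (Tdep r))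
  ¬T : ∀ i → T i ≢ true
  ¬T zero    T₀≡1 = contradiction (trans (sym T₀) T₀≡1) λ ()
  ¬T (suc i) Tᵢ≡1 = contradiction (trans (sym (T′≡0 i)) Tᵢ≡1) λ ()

-- G Y = 1 makes Y injective, hence surjective: z = Y x, and x = G Y x = G z.
rightInverse⇒kernelTrivial : (G Y : Matrix n) → (∀ v w → (G *ᵥ λ z → Y z v) w ≡ identity w v) → KernelTrivial G
rightInverse⇒kernelTrivial G Y GY≡I z Gz≡0 j = trans (sym (Yx≡z j)) (trans (*ᵥ-cong Y x≡0 j) (*ᵥ-zero Y j))
  where
  G[Yx]≡x : ∀ x w → (G *ᵥ Y *ᵥ x) w ≡ x w
  G[Yx]≡x x w = begin
    (G *ᵥ Y *ᵥ x) w                                ≡⟨ *ᵥ-combination G (λ v z → Y z v) x w ⟩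
    combination (λ v → G *ᵥ λ z → Y z v) x w       ≡⟨ sum-cong-≗ (λ v → cong (_∧ x v) (GY≡I v w)) ⟩
    (identity *ᵥ x) w                              ≡⟨ identity-*ᵥ x w ⟩
    x w                                            ∎
    where open ≡-Reasoning
  ker-Y : KernelTrivial Y
  ker-Y x Yx≡0 w = trans (sym (G[Yx]≡x x w)) (trans (*ᵥ-cong G Yx≡0 w) (*ᵥ-zero G w))
  x = proj₁ (kernelTrivial⇒surjective {M = Y} ker-Y z)
  Yx≡z = proj₂ (kernelTrivial⇒surjective {M = Y} ker-Y z)
  x≡0 : IsZero x
  x≡0 l = trans (sym (G[Yx]≡x x l)) (trans (*ᵥ-cong G Yx≡z l) (Gz≡0 l))

-- Determinants

minor : Matrix (suc n) → Fin (suc n) → Matrix n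
minor M c i l = M (suc i) (punchIn c l)

laplaceTerm : Matrix (suc n) → Fin (suc n) → Bool
laplaceTerm {n} M c = M zero c ∧ detZ2 n (minor M c)

laplaceSum : Matrix (suc n) → ∀ k → (Fin k → Fin (suc n)) → Bool
laplaceSum M zero    f = false
laplaceSum M (suc k) f = laplaceTerm M (f zero) xor laplaceSum M k (f ∘ suc)

det-laplace : ∀ n (M : Matrix (suc n)) → detZ2 (suc n) M ≡ sum (laplaceTerm M)
det-laplace n M = trans (unfold n M) (foldr-unique _xor_ false (laplaceTerm M) {g = laplaceSum M} (λ _ → refl) (λ _ _ → refl) (suc n) (λ c → c))
  where
  unfold : ∀ n (M : Matrix (suc n)) → detZ2 (suc n) M ≡ laplaceSum M (suc n) (λ c → c)
  unfold zero    M = refl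
  unfold (suc n) M with laplaceTerm M zero | laplaceTerm M (suc zero)
  ... | t₀ | t₁ with suc n | M | (Fin n → Fin (suc (suc n))) ∋ (λ j → suc (suc j))
  ...   | _ | N | f with foldr-unique _xor_ false (laplaceTerm N) {g = _} (λ _ → refl) (λ _ _ → refl)
                       | foldr-unique _xor_ false (laplaceTerm N) {g = laplaceSum N} (λ _ → refl) (λ _ _ → refl) | n | f
  ...     | unique | unique′ | k | g = cong (λ s → t₀ xor (t₁ xor s)) (trans (unique k g) (sym (unique′ k g)))

det-cong : ∀ n {M N : Matrix n} → (∀ i j → M i j ≡ N i j) → detZ2 n M ≡ detZ2 n N
det-cong zero    _ = refl
det-cong (suc n) {M} {N} M≡N = begin
  detZ2 (suc n) M     ≡⟨ det-laplace n M ⟩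
  sum (laplaceTerm M) ≡⟨ sum-cong-≗ (λ c → cong₂ _∧_ (M≡N zero c) (det-cong n (λ i l → M≡N (suc i) (punchIn c l)))) ⟩
  sum (laplaceTerm N) ≡⟨ det-laplace n N ⟨
  detZ2 (suc n) N     ∎
  where open ≡-Reasoning

det-permuteColumns : ∀ n (M : Matrix n) (π : Permutation′ n) → detZ2 n (λ i j → M i (π ⟨$⟩ʳ j)) ≡ detZ2 n M
det-permuteColumns zero    M π = refl
det-permuteColumns (suc n) M π = begin
  detZ2 (suc n) Mπ                               ≡⟨ det-laplace n Mπ ⟩
  sum (laplaceTerm Mπ)                           ≡⟨ sum-cong-≗ (λ c → cong (M zero (π ⟨$⟩ʳ c) ∧_) (minor-permuted c)) ⟩
  sum (λ c → laplaceTerm M (π ⟨$⟩ʳ c))           ≡⟨ sum-permute (laplaceTerm M) π ⟨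
  sum (laplaceTerm M)                            ≡⟨ det-laplace n M ⟨
  detZ2 (suc n) M                                ∎
  where
  open ≡-Reasoning
  Mπ : Matrix (suc n)
  Mπ i j = M i (π ⟨$⟩ʳ j)
  minor-permuted : ∀ c → detZ2 n (minor Mπ c) ≡ detZ2 n (minor M (π ⟨$⟩ʳ c))
  minor-permuted c = trans (det-cong n (λ i l → cong (M (suc i)) (punchIn-permute π c l)))
                           (det-permuteColumns n (minor M (π ⟨$⟩ʳ c)) (remove c π))

withColumn : Matrix n → Fin n → Vector Bool n → Matrix n
withColumn M a x i = updateAt (M i) a (λ _ → x i)

withColumn-at : (M : Matrix n) (a : Fin n) (x : Vector Bool n) → ∀ i → withColumn M a x i a ≡ x i
withColumn-at M a x i = updateAt-updates a (M i)

withColumn-off : (M : Matrix n) {a j : Fin n} (x : Vector Bool n) → ∀ i → j ≢ a → withColumn M a x i j ≡ M i j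
withColumn-off M {a} {j} x i j≢a = updateAt-minimal j a (M i) j≢a

withColumn-cong : (M : Matrix n) (a : Fin n) {x y : Vector Bool n} → (∀ i → x i ≡ y i) →
                  ∀ i j → withColumn M a x i j ≡ withColumn M a y i j
withColumn-cong M a x≡y i j = cong (λ z → updateAt (M i) a (λ _ → z) j) (x≡y i)

withColumn-self : (M : Matrix n) (a : Fin n) → ∀ i j → withColumn M a (λ i → M i a) i j ≡ M i j
withColumn-self M a i j with j ≟ a
... | yes refl = withColumn-at M j (λ i → M i j) i
... | no  j≢a  = withColumn-off M (λ i → M i a) i j≢a

minor-withColumn-at : (M : Matrix (suc n)) (a : Fin (suc n)) (x : Vector Bool (suc n)) → ∀ i l → minor (withColumn M a x) a i l ≡ minor M a i l
minor-withColumn-at M a x i l = withColumn-off M x (suc i) (punchInᵢ≢i a l)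

minor-withColumn : (M : Matrix (suc n)) {a c : Fin (suc n)} (c≢a : c ≢ a) (x : Vector Bool (suc n)) →
                   ∀ i l → minor (withColumn M a x) c i l ≡ withColumn (minor M c) (punchOut c≢a) (x ∘ suc) i l
minor-withColumn M {a} {c} c≢a x i l with l ≟ punchOut c≢a
... | yes refl = trans (cong (withColumn M a x (suc i)) (punchIn-punchOut c≢a))
                       (trans (withColumn-at M a x (suc i)) (sym (withColumn-at (minor M c) _ (x ∘ suc) i)))
... | no  l≢a′ = trans (withColumn-off M x (suc i) cl≢a) (sym (withColumn-off (minor M c) (x ∘ suc) i l≢a′))
  where
  cl≢a : punchIn c l ≢ a
  cl≢a cl≡a = l≢a′ (trans (sym (punchOut-punchIn c)) (punchOut-cong c cl≡a))

laplaceTerm-withColumn-at : (M : Matrix (suc n)) (a : Fin (suc n)) (x : Vector Bool (suc n)) →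
                            laplaceTerm (withColumn M a x) a ≡ x zero ∧ detZ2 n (minor M a)
laplaceTerm-withColumn-at {n} M a x = cong₂ _∧_ (withColumn-at M a x zero) (det-cong n (minor-withColumn-at M a x))

laplaceTerm-withColumn-off : (M : Matrix (suc n)) {a c : Fin (suc n)} (c≢a : c ≢ a) (x : Vector Bool (suc n)) →
                             laplaceTerm (withColumn M a x) c ≡ M zero c ∧ detZ2 n (withColumn (minor M c) (punchOut c≢a) (x ∘ suc))
laplaceTerm-withColumn-off {n} M c≢a x = cong₂ _∧_ (withColumn-off M x zero c≢a) (det-cong n (minor-withColumn M c≢a x))

det-linear : ∀ n (M : Matrix n) (a : Fin n) (x y : Vector Bool n) →
             detZ2 n (withColumn M a (x +ᵥ y)) ≡ detZ2 n (withColumn M a x) xor detZ2 n (withColumn M a y)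
det-linear (suc n) M a x y = begin
  detZ2 (suc n) (col (x +ᵥ y))                                ≡⟨ det-laplace n (col (x +ᵥ y)) ⟩
  sum (laplaceTerm (col (x +ᵥ y)))                            ≡⟨ sum-cong-≗ term ⟩
  sum (λ c → laplaceTerm (col x) c xor laplaceTerm (col y) c) ≡⟨ ∑-distrib-+ (laplaceTerm (col x)) (laplaceTerm (col y)) ⟩
  sum (laplaceTerm (col x)) xor sum (laplaceTerm (col y))     ≡⟨ cong₂ _xor_ (det-laplace n (col x)) (det-laplace n (col y)) ⟨
  detZ2 (suc n) (col x) xor detZ2 (suc n) (col y)             ∎
  where
  open ≡-Reasoning
  col = withColumn M a
  term : ∀ c → laplaceTerm (col (x +ᵥ y)) c ≡ laplaceTerm (col x) c xor laplaceTerm (col y) c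
  term c with c ≟ a
  ... | yes refl = begin
    laplaceTerm (col (x +ᵥ y)) c                    ≡⟨ laplaceTerm-withColumn-at M c (x +ᵥ y) ⟩
    (x zero xor y zero) ∧ D                         ≡⟨ ∧-distribʳ-xor D (x zero) (y zero) ⟩
    x zero ∧ D xor y zero ∧ D                       ≡⟨ cong₂ _xor_ (laplaceTerm-withColumn-at M c x) (laplaceTerm-withColumn-at M c y) ⟨
    laplaceTerm (col x) c xor laplaceTerm (col y) c ∎
    where D = detZ2 n (minor M c)
  ... | no c≢a = begin
    laplaceTerm (col (x +ᵥ y)) c                    ≡⟨ laplaceTerm-withColumn-off M c≢a (x +ᵥ y) ⟩
    M zero c ∧ D (x +ᵥ y)                           ≡⟨ cong (M zero c ∧_) (det-linear n (minor M c) (punchOut c≢a) (x ∘ suc) (y ∘ suc)) ⟩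
    M zero c ∧ (D x xor D y)                        ≡⟨ ∧-distribˡ-xor (M zero c) (D x) (D y) ⟩
    M zero c ∧ D x xor M zero c ∧ D y               ≡⟨ cong₂ _xor_ (laplaceTerm-withColumn-off M c≢a x) (laplaceTerm-withColumn-off M c≢a y) ⟨
    laplaceTerm (col x) c xor laplaceTerm (col y) c ∎
    where
    D : Vector Bool (suc n) → Bool
    D z = detZ2 n (withColumn (minor M c) (punchOut c≢a) (z ∘ suc))

det-zeroColumn : ∀ n (M : Matrix n) a → (∀ i → M i a ≡ false) → detZ2 n M ≡ false
det-zeroColumn n M a Mᵢₐ≡0 = begin
  detZ2 n M                                   ≡⟨ det-cong n (λ i j → trans (sym (withColumn-self M a i j)) (withColumn-cong M a Mᵢₐ≡0 i j)) ⟩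
  detZ2 n (withColumn M a (λ _ → false))      ≡⟨ det-linear n M a (λ _ → false) (λ _ → false) ⟩
  detZ2 n (withColumn M a (λ _ → false)) xor detZ2 n (withColumn M a (λ _ → false)) ≡⟨ xor-same (detZ2 n (withColumn M a (λ _ → false))) ⟩
  false                                       ∎
  where open ≡-Reasoning

det-scaleColumn : ∀ n (M : Matrix n) a x b → detZ2 n (withColumn M a (λ i → x i ∧ b)) ≡ detZ2 n (withColumn M a x) ∧ b
det-scaleColumn n M a x true  = trans (det-cong n (withColumn-cong M a (λ i → ∧-identityʳ (x i)))) (sym (∧-identityʳ _))
det-scaleColumn n M a x false =
  trans (det-zeroColumn n _ a (λ i → trans (withColumn-at M a (λ i → x i ∧ false) i) (∧-zeroʳ (x i)))) (sym (∧-zeroʳ _))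

det-sumColumn : ∀ n (M : Matrix n) a {k} (h : Fin k → Vector Bool n) →
                detZ2 n (withColumn M a (λ i → sum (λ t → h t i))) ≡ sum (λ t → detZ2 n (withColumn M a (h t)))
det-sumColumn n M a {zero}  h = det-zeroColumn n _ a (withColumn-at M a (λ _ → false))
det-sumColumn n M a {suc k} h =
  trans (det-linear n M a (h zero) (λ i → sum (λ t → h (suc t) i)))
        (cong (detZ2 n (withColumn M a (h zero)) xor_) (det-sumColumn n M a (h ∘ suc)))

det-equalColumns : ∀ n (M : Matrix n) {a b} → a ≢ b → (∀ i → M i a ≡ M i b) → detZ2 n M ≡ false
det-equalColumns (suc n) M {a} {b} a≢b Mₐ≡M_b = begin
  detZ2 (suc n) M                               ≡⟨ det-laplace n M ⟩
  sum (laplaceTerm M)                           ≡⟨ sum-pair (laplaceTerm M) a≢b vanishing ⟩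
  laplaceTerm M a xor laplaceTerm M b           ≡⟨ cong (_xor laplaceTerm M b) termₐ≡term_b ⟩
  laplaceTerm M b xor laplaceTerm M b           ≡⟨ xor-same (laplaceTerm M b) ⟩
  false                                         ∎
  where
  open ≡-Reasoning
  vanishing : ∀ c → c ≢ a → c ≢ b → laplaceTerm M c ≡ false
  vanishing c c≢a c≢b = trans (cong (M zero c ∧_) (det-equalColumns n (minor M c)
      (λ a′≡b′ → a≢b (punchOut-injective c≢a c≢b a′≡b′))
      (λ i → trans (cong (M (suc i)) (punchIn-punchOut c≢a))
               (trans (Mₐ≡M_b (suc i)) (cong (M (suc i)) (sym (punchIn-punchOut c≢b)))))))
    (∧-zeroʳ _)
  -- The columns of minor M b are those of minor M a, permuted by the transposition of a and b.
  σ = remove b (transpose a b)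
  τb≡a : PC.transpose a b b ≡ a
  τb≡a with b ≟ a
  ... | yes b≡a = contradiction (sym b≡a) a≢b
  ... | no _ with b ≟ b
  ...   | yes _  = refl
  ...   | no b≢b = contradiction refl b≢b
  τ-fixes-M : ∀ i j → M i (PC.transpose a b j) ≡ M i j
  τ-fixes-M i j with j ≟ a
  ... | yes refl = sym (Mₐ≡M_b i)
  ... | no _ with j ≟ b
  ...   | yes refl = Mₐ≡M_b i
  ...   | no _     = refl
  termₐ≡term_b : laplaceTerm M a ≡ laplaceTerm M b
  termₐ≡term_b = cong₂ _∧_ (Mₐ≡M_b zero) (begin
    detZ2 n (minor M a)                          ≡⟨ det-permuteColumns n (minor M a) σ ⟨
    detZ2 n (λ i l → M (suc i) (punchIn a (σ ⟨$⟩ʳ l)))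
      ≡⟨ det-cong n (λ i l → trans (cong (λ z → M (suc i) (punchIn z (σ ⟨$⟩ʳ l))) (sym τb≡a))
                              (trans (cong (M (suc i)) (sym (punchIn-permute (transpose a b) b l)))
                                     (τ-fixes-M (suc i) (punchIn b l)))) ⟩
    detZ2 n (minor M b)                          ∎)

det-withColumn-*ᵥ : ∀ n (M : Matrix n) a S → detZ2 n (withColumn M a (M *ᵥ S)) ≡ detZ2 n M ∧ S a
det-withColumn-*ᵥ n M a S = begin
  detZ2 n (withColumn M a (M *ᵥ S))                             ≡⟨ det-sumColumn n M a (λ t i → M i t ∧ S t) ⟩
  sum (λ t → detZ2 n (withColumn M a (λ i → M i t ∧ S t)))      ≡⟨ sum-cong-≗ (λ t → det-scaleColumn n M a (λ i → M i t) (S t)) ⟩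
  sum (λ t → detZ2 n (withColumn M a (λ i → M i t)) ∧ S t)      ≡⟨ sum-single (λ t → detZ2 n (withColumn M a (λ i → M i t)) ∧ S t) a vanishing ⟩
  detZ2 n (withColumn M a (λ i → M i a)) ∧ S a                  ≡⟨ cong (_∧ S a) (det-cong n (withColumn-self M a)) ⟩
  detZ2 n M ∧ S a                                               ∎
  where
  open ≡-Reasoning
  vanishing : ∀ t → t ≢ a → detZ2 n (withColumn M a (λ i → M i t)) ∧ S t ≡ false
  vanishing t t≢a = cong (_∧ S t) (det-equalColumns n _ (λ a≡t → t≢a (sym a≡t))
    (λ i → trans (withColumn-at M a (λ i → M i t) i) (sym (withColumn-off M (λ i → M i t) i t≢a))))

det-withColumn-*ᵥ-invariant : ∀ n (M : Matrix n) a S → S a ≡ true → detZ2 n (withColumn M a (M *ᵥ S)) ≡ detZ2 n M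
det-withColumn-*ᵥ-invariant n M a S Sₐ =
  trans (det-withColumn-*ᵥ n M a S) (trans (cong (detZ2 n M ∧_) Sₐ) (∧-identityʳ _))

unit₀ : Vector Bool (suc n)
unit₀ zero    = true
unit₀ (suc _) = false

det-unitColumn : ∀ n (M : Matrix (suc n)) a → detZ2 (suc n) (withColumn M a unit₀) ≡ detZ2 n (minor M a)
det-unitColumn n M a = begin
  detZ2 (suc n) (withColumn M a unit₀)     ≡⟨ det-laplace n (withColumn M a unit₀) ⟩
  sum (laplaceTerm (withColumn M a unit₀)) ≡⟨ sum-single (laplaceTerm (withColumn M a unit₀)) a vanishing ⟩
  laplaceTerm (withColumn M a unit₀) a     ≡⟨ laplaceTerm-withColumn-at M a unit₀ ⟩
  true ∧ detZ2 n (minor M a)               ∎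
  where
  open ≡-Reasoning
  vanishing : ∀ c → c ≢ a → laplaceTerm (withColumn M a unit₀) c ≡ false
  vanishing c c≢a = trans (laplaceTerm-withColumn-off M c≢a unit₀)
    (trans (cong (M zero c ∧_) (det-zeroColumn n _ (punchOut c≢a) (withColumn-at (minor M c) (punchOut c≢a) (unit₀ ∘ suc))))
           (∧-zeroʳ _))

det-singular : ∀ n (M : Matrix n) y → IsNonzero y → IsZero (M *ᵥ y) → detZ2 n M ≡ false
det-singular n M y (j , yⱼ) My≡0 =
  trans (sym (det-withColumn-*ᵥ-invariant n M j y yⱼ)) (det-zeroColumn n _ j (λ i → trans (withColumn-at M j (M *ᵥ y) i) (My≡0 i)))

det≡true⇒kernelTrivial : ∀ n (M : Matrix n) → detZ2 n M ≡ true → KernelTrivial M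
det≡true⇒kernelTrivial n M det≡1 y My≡0 j with y j in yⱼ
... | false = refl
... | true  = contradiction (trans (sym det≡1) (det-singular n M y (j , yⱼ) My≡0)) λ ()

*ᵥ-insertAt-false : (M : Matrix (suc n)) (a : Fin (suc n)) (y : Vector Bool n) →
                    ∀ i → (M *ᵥ insertAt y a false) i ≡ (λ l → M i (punchIn a l)) · y
*ᵥ-insertAt-false M a y i = begin
  (M *ᵥ insertAt y a false) i                                   ≡⟨ sum-remove {i = a} (λ c → M i c ∧ insertAt y a false c) ⟩
  M i a ∧ insertAt y a false a xor sum (λ l → M i (punchIn a l) ∧ insertAt y a false (punchIn a l))
    ≡⟨ cong₂ _xor_ (trans (cong (M i a ∧_) (insertAt-lookup y a false)) (∧-zeroʳ (M i a)))
                   (sum-cong-≗ (λ l → cong (M i (punchIn a l) ∧_) (insertAt-punchIn y a false l))) ⟩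
  (λ l → M i (punchIn a l)) · y                                  ∎
  where open ≡-Reasoning

-- If M S = e₀ with S a = 1, then a vector y in the kernel of the minor at a extends,
-- by a zero at a, to a vector Y with M Y ∈ {0, e₀}; so Y = 0 or Y = S.
minor-kernelTrivial : (M : Matrix (suc n)) → KernelTrivial M → ∀ S → (∀ i → (M *ᵥ S) i ≡ unit₀ i) →
                      ∀ a → S a ≡ true → KernelTrivial (minor M a)
minor-kernelTrivial M ker S MS≡e₀ a Sₐ y My≡0 l = trans (sym (insertAt-punchIn y a false l)) (Y≡0 (punchIn a l))
  where
  Y = insertAt y a false
  β = (λ l → M zero (punchIn a l)) · y
  MY≡βe₀ : ∀ i → (M *ᵥ Y) i ≡ unit₀ i ∧ β
  MY≡βe₀ zero    = *ᵥ-insertAt-false M a y zero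
  MY≡βe₀ (suc i) = trans (*ᵥ-insertAt-false M a y (suc i)) (My≡0 i)
  Y≡0 : IsZero Y
  Y≡0 with β in β≡
  ... | false = ker Y (λ i → trans (MY≡βe₀ i) (trans (cong (unit₀ i ∧_) β≡) (∧-zeroʳ _)))
  ... | true  = contradiction (trans (sym (cong₂ _xor_ (insertAt-lookup y a false) Sₐ)) (ker (Y +ᵥ S) M[Y+S]≡0 a)) λ ()
    where
    M[Y+S]≡0 : IsZero (M *ᵥ (Y +ᵥ S))
    M[Y+S]≡0 i = begin
      (M *ᵥ (Y +ᵥ S)) i         ≡⟨ *ᵥ-+ᵥ M Y S i ⟩
      (M *ᵥ Y) i xor (M *ᵥ S) i ≡⟨ cong₂ _xor_ (trans (MY≡βe₀ i) (trans (cong (unit₀ i ∧_) β≡) (∧-identityʳ _))) (MS≡e₀ i) ⟩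
      unit₀ i xor unit₀ i       ≡⟨ xor-same (unit₀ i) ⟩
      false                     ∎
      where open ≡-Reasoning

kernelTrivial⇒det≡true : ∀ n (M : Matrix n) → KernelTrivial M → detZ2 n M ≡ true
kernelTrivial⇒det≡true zero    M ker = refl
kernelTrivial⇒det≡true (suc n) M ker with kernelTrivial⇒surjective {M = M} ker unit₀
... | S , MS≡e₀ with search S
...   | inj₂ S≡0 = contradiction (trans (sym (MS≡e₀ zero)) (sum-zero (λ j → trans (cong (M zero j ∧_) (S≡0 j)) (∧-zeroʳ _)))) λ ()
...   | inj₁ (a , Sₐ) = begin
  detZ2 (suc n) M                            ≡⟨ det-withColumn-*ᵥ-invariant (suc n) M a S Sₐ ⟨
  detZ2 (suc n) (withColumn M a (M *ᵥ S))    ≡⟨ det-cong (suc n) (withColumn-cong M a MS≡e₀) ⟩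
  detZ2 (suc n) (withColumn M a unit₀)       ≡⟨ det-unitColumn n M a ⟩
  detZ2 n (minor M a)                        ≡⟨ kernelTrivial⇒det≡true n (minor M a) (minor-kernelTrivial M ker S MS≡e₀ a Sₐ) ⟩
  true                                       ∎
  where open ≡-Reasoning

-- Krylov relations

power : Matrix n → ℕ → Matrix n
power G zero    = identity
power G (suc k) w v = (G *ᵥ λ z → power G k z v) w

krylov : ∀ {m} → Matrix n → Fin n → Fin m → Vector Bool n
krylov G v j w = power G (toℕ j) w v

krylovEquations : Matrix n → Fin n → Equations n n
krylovEquations G v w j = krylov G v j w

KrylovRelation : Matrix n → Fin n → Set
KrylovRelation G v = Solvable (krylovEquations G v)

krylov-step : ∀ {m} (G : Matrix n) v (c : Vector Bool (suc m)) → ∀ w →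
              combination (krylov G v) c w ≡ identity w v ∧ c zero xor (G *ᵥ combination (krylov G v) (c ∘ suc)) w
krylov-step G v c w = cong (identity w v ∧ c zero xor_) (sym (*ᵥ-combination G (krylov G v) (c ∘ suc) w))

krylovRelations⇒kernelTrivial : (G : Matrix n) → (∀ v → KrylovRelation G v) → KernelTrivial G
krylovRelations⇒kernelTrivial G relation = rightInverse⇒kernelTrivial G Y GY≡I
  where
  Y : Matrix _
  Y z v = combination (krylov G v) (proj₁ (relation v) ∘ suc) z
  GY≡I : ∀ v w → (G *ᵥ λ z → Y z v) w ≡ identity w v
  GY≡I v w = let c , c₀ , Σc≡0 = relation v in sym (begin
    identity w v                                  ≡⟨ ∧-identityʳ _ ⟨
    identity w v ∧ true                           ≡⟨ cong (identity w v ∧_) c₀ ⟨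
    identity w v ∧ c zero                         ≡⟨ xor≡false⇒≡ _ _ (trans (sym (krylov-step G v c w)) (Σc≡0 w)) ⟩
    (G *ᵥ λ z → Y z v) w                          ∎)
    where open ≡-Reasoning

insertAt-last-inject₁ : ∀ {A : Set} (xs : Vector A n) a j → insertAt xs (fromℕ n) a (inject₁ j) ≡ xs j
insertAt-last-inject₁ {suc n} xs a zero    = refl
insertAt-last-inject₁ {suc n} xs a (suc j) = insertAt-last-inject₁ (xs ∘ suc) a j

shiftDown : Vector Bool (suc n) → Vector Bool (suc n)
shiftDown {n} c = insertAt (c ∘ suc) (fromℕ n) false

-- Without a constant term, a relation is G applied to a relation among fewer
-- powers, which survives because G is injective.
shiftDown-relation : (G : Matrix n) → KernelTrivial G → ∀ v (c : Vector Bool (suc n)) → c zero ≡ false →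
                     IsZero (combination (krylov G v) c) → IsZero (combination (krylov G v) (shiftDown c))
shiftDown-relation {n} G ker v c c₀ Σc≡0 w = begin
  combination (krylov G v) (shiftDown c) w
    ≡⟨ sum-init-last (λ j → krylov G v j w ∧ shiftDown c j) ⟩
  sum (λ l → krylov G v (inject₁ l) w ∧ shiftDown c (inject₁ l)) xor krylov G v (fromℕ n) w ∧ shiftDown c (fromℕ n)
    ≡⟨ cong₂ _xor_ (sum-cong-≗ (λ l → cong₂ (λ k b → power G k w v ∧ b) (toℕ-inject₁ l) (insertAt-last-inject₁ (c ∘ suc) false l)))
                   (trans (cong (_ ∧_) (insertAt-lookup (c ∘ suc) (fromℕ n) false)) (∧-zeroʳ _)) ⟩
  combination (krylov G v) (c ∘ suc) w xor false
    ≡⟨ cong (_xor false) (ker _ G[Σc′]≡0 w) ⟩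
  false ∎
  where
  open ≡-Reasoning
  G[Σc′]≡0 : IsZero (G *ᵥ combination (krylov G v) (c ∘ suc))
  G[Σc′]≡0 w = begin
    false xor (G *ᵥ combination (krylov G v) (c ∘ suc)) w
      ≡⟨ cong (_xor (G *ᵥ combination (krylov G v) (c ∘ suc)) w) (trans (sym (∧-zeroʳ (identity w v))) (cong (identity w v ∧_) (sym c₀))) ⟩
    identity w v ∧ c zero xor (G *ᵥ combination (krylov G v) (c ∘ suc)) w
      ≡⟨ krylov-step G v c w ⟨
    combination (krylov G v) c w
      ≡⟨ Σc≡0 w ⟩
    false ∎

kernelTrivial⇒krylovRelation : (G : Matrix n) → KernelTrivial G → ∀ v → KrylovRelation G v
kernelTrivial⇒krylovRelation G ker v =
  let S , (i , Sᵢ) , ΣS≡0 = dependent ≤-refl (krylov G v) in normalise (toℕ i) S i refl Sᵢ ΣS≡0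
  where
  normalise : ∀ p c i → toℕ i ≡ p → c i ≡ true → IsZero (combination (krylov G v) c) → KrylovRelation G v
  normalise p       c zero    _   c₀ Σc≡0 = c , c₀ , Σc≡0
  normalise (suc p) c (suc i) i≡p cᵢ Σc≡0 with c zero Bool.≟ true
  ... | yes c₀   = c , c₀ , Σc≡0
  ... | no  c₀≢1 = normalise p (shiftDown c) (inject₁ i) (trans (toℕ-inject₁ i) (suc-injective i≡p))
                          (trans (insertAt-last-inject₁ (c ∘ suc) false i) cᵢ) (shiftDown-relation G ker v c (¬-not c₀≢1) Σc≡0)

-- Gaussian elimination without an order on the rows

-- min i n
clamp : ℕ → Fin (suc n)
clamp         zero    = zero
clamp {zero}  (suc _) = zero
clamp {suc n} (suc i) = suc (clamp i)

clamp-toℕ : (j : Fin (suc n)) → clamp (toℕ j) ≡ j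
clamp-toℕ         zero    = refl
clamp-toℕ {suc n} (suc j) = cong suc (clamp-toℕ j)

toℕ-clamp : ∀ i → i ≤ n → toℕ (clamp {n} i) ≡ i
toℕ-clamp zero    _         = refl
toℕ-clamp (suc i) (s≤s i≤n) = cong suc (toℕ-clamp i i≤n)

refine : Equations m n → Vector Bool m → Fin (suc n) → Vector Bool m
refine r C col u = C u ∧ (not (r u col) ∨ not (or λ u′ → C u′ ∧ not (r u′ col)))

refine-⊆ : ∀ (r : Equations m n) C col u → refine r C col u ≡ true → C u ≡ true
refine-⊆ r C col u = ∧-conicalˡ _ _

refine-nonempty : ∀ (r : Equations m n) C col → IsNonzero C → IsNonzero (refine r C col)
refine-nonempty r C col (u , Cᵤ) with search (λ u′ → C u′ ∧ not (r u′ col))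
... | inj₁ (u′ , Cᵤ′∧¬r) =
  u′ , cong₂ _∧_ (∧-conicalˡ (C u′) _ Cᵤ′∧¬r) (cong (_∨ _) (∧-conicalʳ (C u′) (not (r u′ col)) Cᵤ′∧¬r))
... | inj₂ C∧¬r≡0 = u , cong₂ _∧_ Cᵤ (trans (cong (λ b → not (r u col) ∨ not b) (or-false C∧¬r≡0)) (∨-zeroʳ _))

refine-agree : ∀ (r : Equations m n) C col {u u′} → refine r C col u ≡ true → refine r C col u′ ≡ true → r u col ≡ r u′ col
refine-agree r C col {u} {u′} Rᵤ Rᵤ′ with or (λ u″ → C u″ ∧ not (r u″ col)) in some
... | true  = trans (zeroAt (∧-conicalʳ _ _ Rᵤ)) (sym (zeroAt (∧-conicalʳ _ _ Rᵤ′)))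
  where
  zeroAt : ∀ {b} → not b ∨ false ≡ true → b ≡ false
  zeroAt {false} _ = refl
... | false = trans (oneAt (∧-conicalˡ _ _ Rᵤ)) (sym (oneAt (∧-conicalˡ _ _ Rᵤ′)))
  where
  oneAt : ∀ {u″} → C u″ ≡ true → r u″ col ≡ true
  oneAt {u″} Cᵤ″ with r u″ col in rᵤ″
  ... | true  = refl
  ... | false = trans (sym (or-false⁻¹ _ some u″)) (cong₂ (λ a b → a ∧ not b) Cᵤ″ rᵤ″)

-- The rows with a 1 in column k, narrowed column by column (columns 0 … t) to
-- those agreeing with a lexicographically least one: a canonical pivot row
-- that needs no ordering of the rows.
candidates : Equations m n → Fin (suc n) → ℕ → Vector Bool m
candidates r k zero    = refine r (λ u → r u k) zero
candidates r k (suc t) = refine r (candidates r k t) (clamp (suc t))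

candidates-⊆ : ∀ (r : Equations m n) k t u → candidates r k t u ≡ true → r u k ≡ true
candidates-⊆ r k zero    u = refine-⊆ r _ zero u
candidates-⊆ r k (suc t) u = candidates-⊆ r k t u ∘ refine-⊆ r _ (clamp (suc t)) u

candidates-nonempty : ∀ (r : Equations m n) k → IsNonzero (λ u → r u k) → ∀ t → IsNonzero (candidates r k t)
candidates-nonempty r k ne zero    = refine-nonempty r _ zero ne
candidates-nonempty r k ne (suc t) = refine-nonempty r _ (clamp (suc t)) (candidates-nonempty r k ne t)

candidates-agree : ∀ (r : Equations m n) k t {col} → toℕ col ≤ t → ∀ {u u′} →
                   candidates r k t u ≡ true → candidates r k t u′ ≡ true → r u col ≡ r u′ col
candidates-agree r k zero    {zero} _ Cᵤ Cᵤ′ = refine-agree r _ zero Cᵤ Cᵤ′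
candidates-agree r k (suc t) {col} col≤1+t {u} {u′} Cᵤ Cᵤ′ with m≤n⇒m<n∨m≡n col≤1+t
... | inj₁ col≤t = candidates-agree r k t (s≤s⁻¹ col≤t) (refine-⊆ r _ _ u Cᵤ) (refine-⊆ r _ _ u′ Cᵤ′)
... | inj₂ col≡1+t = subst (λ c → r u c ≡ r u′ c) (trans (cong clamp (sym col≡1+t)) (clamp-toℕ col))
                           (refine-agree r _ (clamp (suc t)) Cᵤ Cᵤ′)

pivotRow : Equations m n → Fin (suc n) → Vector Bool (suc n)
pivotRow {n = n} r k col = or λ u → candidates r k n u ∧ r u col

pivotRow-cases : ∀ (r : Equations m n) k →
                 (∃ λ u → r u k ≡ true × ∀ col → pivotRow r k col ≡ r u col) ⊎
                 ((∀ u → r u k ≡ false) × IsZero (pivotRow r k))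
pivotRow-cases {n = n} r k with search (λ u → r u k)
... | inj₂ column≡0 = inj₂ (column≡0 , λ col → or-false (notCandidate col))
  where
  notCandidate : ∀ col u → candidates r k n u ∧ r u col ≡ false
  notCandidate col u with candidates r k n u in Cᵤ
  ... | false = refl
  ... | true  = contradiction (trans (sym (column≡0 u)) (candidates-⊆ r k n u Cᵤ)) λ ()
... | inj₁ ne = let u , Cᵤ = candidates-nonempty r k ne n in
  inj₁ (u , candidates-⊆ r k n u Cᵤ , λ col → isRow u Cᵤ col)
  where
  isRow : ∀ u → candidates r k n u ≡ true → ∀ col → pivotRow r k col ≡ r u col
  isRow u Cᵤ col with r u col in rᵤ
  ... | true  = or-true _ u (cong₂ _∧_ Cᵤ rᵤ)
  ... | false = or-false λ u′ → agree u′
    where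
    agree : ∀ u′ → candidates r k n u′ ∧ r u′ col ≡ false
    agree u′ with candidates r k n u′ in Cᵤ′
    ... | false = refl
    ... | true  = trans (candidates-agree r k n (toℕ≤pred[n] col) Cᵤ′ Cᵤ) rᵤ

pivotRow-leading : ∀ (r : Equations m n) k → IsZero (pivotRow r k) ⊎ pivotRow r k k ≡ true
pivotRow-leading r k with pivotRow-cases r k
... | inj₁ (u , rᵤₖ , pivot≡rᵤ) = inj₂ (trans (pivot≡rᵤ k) rᵤₖ)
... | inj₂ (_ , pivot≡0)        = inj₁ pivot≡0

pivotRow-zeroColumn : ∀ (r : Equations m n) k {col} → (∀ u → r u col ≡ false) → pivotRow r k col ≡ false
pivotRow-zeroColumn {n = n} r k {col} column≡0 = or-false λ u → trans (cong (candidates r k n u ∧_) (column≡0 u)) (∧-zeroʳ _)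

pivotRow-solution : ∀ (r : Equations m n) k c → (∀ w → r w · c ≡ false) → pivotRow r k · c ≡ false
pivotRow-solution r k c solves with pivotRow-cases r k
... | inj₁ (u , _ , pivot≡rᵤ) = trans (sum-cong-≗ (λ j → cong (_∧ c j) (pivot≡rᵤ j))) (solves u)
... | inj₂ (_ , pivot≡0)      = sum-zero (λ j → cong (_∧ c j) (pivot≡0 j))

eliminate : Equations m n → Fin (suc n) → Equations m n
eliminate r k w col = r w col xor r w k ∧ pivotRow r k col

eliminate-· : ∀ (r : Equations m n) k w c → eliminate r k w · c ≡ r w · c xor r w k ∧ pivotRow r k · c
eliminate-· r k w c = begin
  sum (λ j → (r w j xor r w k ∧ pivotRow r k j) ∧ c j)
    ≡⟨ sum-cong-≗ (λ j → ∧-distribʳ-xor (c j) (r w j) (r w k ∧ pivotRow r k j)) ⟩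
  sum (λ j → r w j ∧ c j xor (r w k ∧ pivotRow r k j) ∧ c j)
    ≡⟨ ∑-distrib-+ (λ j → r w j ∧ c j) (λ j → (r w k ∧ pivotRow r k j) ∧ c j) ⟩
  r w · c xor sum (λ j → (r w k ∧ pivotRow r k j) ∧ c j)
    ≡⟨ cong (r w · c xor_) (trans (sum-cong-≗ (λ j → ∧-assoc (r w k) (pivotRow r k j) (c j)))
                                  (sym (*-distribˡ-sum (r w k) (λ j → pivotRow r k j ∧ c j)))) ⟩
  r w · c xor r w k ∧ pivotRow r k · c ∎
  where open ≡-Reasoning

eliminate-solution : ∀ (r : Equations m n) k c → (∀ w → r w · c ≡ false) → ∀ w → eliminate r k w · c ≡ false
eliminate-solution r k c solves w =
  trans (eliminate-· r k w c) (trans (cong₂ (λ a b → a xor r w k ∧ b) (solves w) (pivotRow-solution r k c solves)) (∧-zeroʳ (r w k)))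

eliminate-solution⁻¹ : ∀ (r : Equations m n) k c → (∀ w → eliminate r k w · c ≡ false) → pivotRow r k · c ≡ false →
                       ∀ w → r w · c ≡ false
eliminate-solution⁻¹ r k c solves pivot·c≡0 w =
  trans (xor≡false⇒≡ _ _ (trans (sym (eliminate-· r k w c)) (solves w))) (trans (cong (r w k ∧_) pivot·c≡0) (∧-zeroʳ (r w k)))

eliminate-clears : ∀ (r : Equations m n) k w → eliminate r k w k ≡ false
eliminate-clears r k w with pivotRow-cases r k
... | inj₁ (u , rᵤₖ , pivot≡rᵤ) =
  trans (cong (λ b → r w k xor r w k ∧ b) (trans (pivot≡rᵤ k) rᵤₖ)) (trans (cong (r w k xor_) (∧-identityʳ _)) (xor-same (r w k)))
... | inj₂ (column≡0 , _) = trans (cong (λ b → b xor b ∧ pivotRow r k k) (column≡0 w)) refl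

eliminate-keepsZero : ∀ (r : Equations m n) k {col} → (∀ u → r u col ≡ false) → ∀ w → eliminate r k w col ≡ false
eliminate-keepsZero r k column≡0 w =
  trans (cong₂ (λ a b → a xor r w k ∧ b) (column≡0 w) (pivotRow-zeroColumn r k column≡0)) (∧-zeroʳ (r w k))

·-flip : (x c : Vector Bool n) (p : Fin n) → x · (λ j → c j xor ⌊ j ≟ p ⌋) ≡ x · c xor x p
·-flip x c p = begin
  sum (λ j → x j ∧ (c j xor ⌊ j ≟ p ⌋))        ≡⟨ sum-cong-≗ (λ j → ∧-distribˡ-xor (x j) (c j) _) ⟩
  sum (λ j → x j ∧ c j xor x j ∧ ⌊ j ≟ p ⌋)    ≡⟨ ∑-distrib-+ (λ j → x j ∧ c j) (λ j → x j ∧ ⌊ j ≟ p ⌋) ⟩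
  x · c xor sum (λ j → x j ∧ ⌊ j ≟ p ⌋)
    ≡⟨ cong (x · c xor_) (sum-single _ p (λ j j≢p → trans (cong (x j ∧_) (≟-false j≢p)) (∧-zeroʳ (x j)))) ⟩
  x · c xor x p ∧ ⌊ p ≟ p ⌋                     ≡⟨ cong (λ b → x · c xor x p ∧ b) (≟-true refl) ⟩
  x · c xor x p ∧ true                          ≡⟨ cong (x · c xor_) (∧-identityʳ (x p)) ⟩
  x · c xor x p                                 ∎
  where open ≡-Reasoning

module Elimination (r₀ : Equations m n) where

  reduced : ℕ → Equations m n
  reduced zero    = r₀
  reduced (suc s) = eliminate (reduced s) (clamp (suc s))

  pivot : ℕ → Vector Bool (suc n)
  pivot s = pivotRow (reduced s) (clamp (suc s))

  reduced-cleared : ∀ s → s ≤ n → ∀ w col → 0 < toℕ col → toℕ col ≤ s → reduced s w col ≡ false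
  reduced-cleared zero    _     w col 0<col col≤0 = contradiction (≤-trans 0<col col≤0) λ ()
  reduced-cleared (suc s) 1+s≤n w col 0<col col≤1+s with m≤n⇒m<n∨m≡n col≤1+s
  ... | inj₁ col≤s   = eliminate-keepsZero (reduced s) _ (λ u → reduced-cleared s (<⇒≤ 1+s≤n) u col 0<col (s≤s⁻¹ col≤s)) w
  ... | inj₂ col≡1+s = subst (λ j → eliminate (reduced s) (clamp (suc s)) w j ≡ false) (trans (cong clamp (sym col≡1+s)) (clamp-toℕ col))
                             (eliminate-clears (reduced s) (clamp (suc s)) w)

  pivot-cleared : ∀ s → s < n → ∀ col → 0 < toℕ col → toℕ col ≤ s → pivot s col ≡ false
  pivot-cleared s s<n col 0<col col≤s = pivotRow-zeroColumn (reduced s) _ (λ u → reduced-cleared s (<⇒≤ s<n) u col 0<col col≤s)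

  reduced-final-· : ∀ w c → reduced n w · c ≡ reduced n w zero ∧ c zero
  reduced-final-· w c = trans (cong (reduced n w zero ∧ c zero xor_) (sum-zero λ j →
                  cong (_∧ c (suc j)) (reduced-cleared n ≤-refl w (suc j) (s≤s z≤n) (toℕ<n j))))
                (xor-identityʳ _)

  forward : ∀ s c → (∀ w → r₀ w · c ≡ false) → ∀ w → reduced s w · c ≡ false
  forward zero    c solves = solves
  forward (suc s) c solves = eliminate-solution (reduced s) _ c (forward s c solves)

  unwind : ∀ s c → (∀ w → reduced s w · c ≡ false) → (∀ s′ → s′ < s → pivot s′ · c ≡ false) → ∀ w → r₀ w · c ≡ false
  unwind zero    c solves _      = solves
  unwind (suc s) c solves pivots =
    unwind s c (eliminate-solution⁻¹ (reduced s) _ c solves (pivots s ≤-refl)) (λ s′ s′<s → pivots s′ (m≤n⇒m≤1+n s′<s))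

  SolvesPivotsFrom : ℕ → Set
  SolvesPivotsFrom t = ∃ λ c → c zero ≡ true × ∀ s → t ≤ s → s < n → pivot s · c ≡ false

  -- Back substitution: pivot t has its leading 1 in column t + 1, where the
  -- later pivots vanish, so flipping that unknown fixes equation t alone.
  backSubstitute : ∀ t → t < n → SolvesPivotsFrom (suc t) → SolvesPivotsFrom t
  backSubstitute t t<n (c , c₀ , solves) with pivot t · c Bool.≟ false
  ... | yes pivot·c≡0 = c , c₀ , λ s t≤s s<n → [ (λ t<s → solves s t<s s<n) , (λ { refl → pivot·c≡0 }) ]′ (m≤n⇒m<n∨m≡n t≤s)
  ... | no  pivot·c≢0 with pivotRow-leading (reduced t) (clamp (suc t))
  ...   | inj₁ pivot≡0 = contradiction (sum-zero (λ j → cong (_∧ c j) (pivot≡0 j))) pivot·c≢0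
  ...   | inj₂ leading = c′ , trans (cong (c zero xor_) (≟-false (λ 0≡p → contradiction (trans (cong toℕ 0≡p) toℕp) λ ())))
                                      (trans (xor-identityʳ (c zero)) c₀) , solves′
    where
    p = clamp {n} (suc t)
    toℕp : toℕ p ≡ suc t
    toℕp = toℕ-clamp (suc t) t<n
    c′ : Vector Bool (suc n)
    c′ j = c j xor ⌊ j ≟ p ⌋
    solves′ : ∀ s → t ≤ s → s < n → pivot s · c′ ≡ false
    solves′ s t≤s s<n with m≤n⇒m<n∨m≡n t≤s
    ... | inj₂ refl = trans (·-flip (pivot t) c p) (trans (cong₂ _xor_ (¬-not pivot·c≢0) leading) refl)
    ... | inj₁ t<s  = trans (·-flip (pivot s) c p)
                        (cong₂ _xor_ (solves s t<s s<n) (pivot-cleared s s<n p (subst (0 <_) (sym toℕp) (s≤s z≤n)) (subst (_≤ s) (sym toℕp) t<s)))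

  solvesPivotsFrom : ∀ d t → t + d ≡ n → SolvesPivotsFrom t
  solvesPivotsFrom zero    t t+0≡n = (λ _ → true) , refl , λ s t≤s s<n →
    contradiction (≤-trans s<n (subst (_≤ s) (trans (sym (+-identityʳ t)) t+0≡n) t≤s)) (n≮n s)
  solvesPivotsFrom (suc d) t t+1+d≡n =
    backSubstitute t (subst (t <_) t+1+d≡n (m<m+n t (s≤s z≤n))) (solvesPivotsFrom d (suc t) (trans (sym (+-suc t d)) t+1+d≡n))

  solvable⇔cleared : Solvable r₀ ⇔ (∀ w → reduced n w zero ≡ false)
  solvable⇔cleared = mk⇔ cleared solvable
    where
    cleared : Solvable r₀ → ∀ w → reduced n w zero ≡ false
    cleared (c , c₀ , solves) w = begin
      reduced n w zero              ≡⟨ ∧-identityʳ _ ⟨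
      reduced n w zero ∧ true       ≡⟨ cong (reduced n w zero ∧_) c₀ ⟨
      reduced n w zero ∧ c zero     ≡⟨ reduced-final-· w c ⟨
      reduced n w · c               ≡⟨ forward n c solves w ⟩
      false                         ∎
      where open ≡-Reasoning
    solvable : (∀ w → reduced n w zero ≡ false) → Solvable r₀
    solvable column₀≡0 = let c , c₀ , pivots = solvesPivotsFrom n 0 refl in
      c , c₀ , unwind n c (λ w → trans (reduced-final-· w c) (cong (_∧ c zero) (column₀≡0 w))) (λ s → pivots s z≤n)

det≡true⇔cleared : ∀ n (G : Matrix n) → detZ2 n G ≡ true ⇔ (∀ v w → Elimination.reduced (krylovEquations G v) n w zero ≡ false)
det≡true⇔cleared n G = mk⇔
  (λ det≡1 v → Equivalence.to (solvable⇔cleared v) (kernelTrivial⇒krylovRelation G (det≡true⇒kernelTrivial n G det≡1) v))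
  (λ cleared → kernelTrivial⇒det≡true n G (krylovRelations⇒kernelTrivial G λ v → Equivalence.from (solvable⇔cleared v) (cleared v)))
  where
  solvable⇔cleared : ∀ v → Solvable (krylovEquations G v) ⇔ (∀ w → Elimination.reduced (krylovEquations G v) n w zero ≡ false)
  solvable⇔cleared v = Elimination.solvable⇔cleared (krylovEquations G v)

-- The FP+Card sentence

v₀ : ∀ {Γ s} → Var (s ∷ Γ) s
v₀ = here

v₁ : ∀ {Γ s a} → Var (a ∷ s ∷ Γ) s
v₁ = there v₀

v₂ : ∀ {Γ s a b} → Var (a ∷ b ∷ s ∷ Γ) s
v₂ = there v₁

v₃ : ∀ {Γ s a b c} → Var (a ∷ b ∷ c ∷ s ∷ Γ) s
v₃ = there v₂

v₄ : ∀ {Γ s a b c d} → Var (a ∷ b ∷ c ∷ d ∷ s ∷ Γ) s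
v₄ = there v₃

v₅ : ∀ {Γ s a b c d e} → Var (a ∷ b ∷ c ∷ d ∷ e ∷ s ∷ Γ) s
v₅ = there v₄

v₆ : ∀ {Γ s a b c d e f} → Var (a ∷ b ∷ c ∷ d ∷ e ∷ f ∷ s ∷ Γ) s
v₆ = there v₅

v₇ : ∀ {Γ s a b c d e f g} → Var (a ∷ b ∷ c ∷ d ∷ e ∷ f ∷ g ∷ s ∷ Γ) s
v₇ = there v₆

infixr 5 _∨ᶠ_ _xorᶠ_
_∨ᶠ_ : ∀ {Γ Δ} → Formula Γ Δ → Formula Γ Δ → Formula Γ Δ
φ ∨ᶠ ψ = neg (and (neg φ) (neg ψ))

_xorᶠ_ : ∀ {Γ Δ} → Formula Γ Δ → Formula Γ Δ → Formula Γ Δ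
φ xorᶠ ψ = and φ (neg ψ) ∨ᶠ and (neg φ) ψ

weaken : ∀ {X Γ s} → Var X s → Var (X ++ Γ) s
weaken here      = here
weaken (there v) = there (weaken v)

varsOf : ∀ {Γ Δ} X → (∀ {s} → Var X s → Var Γ s) → Terms Γ Δ X
varsOf []      f = []
varsOf (s ∷ X) f = var (f here) ∷ varsOf X (f ∘ there)

refinementᶠ : ∀ {Γ Δ} → Formula Γ Δ → Formula Γ Δ → Formula (vtx ∷ Γ) Δ → Formula (vtx ∷ Γ) Δ → Formula Γ Δ
refinementᶠ C Z C′ Z′ = and C (neg Z ∨ᶠ neg (ex vtx (and C′ (neg Z′))))

Stamped : List Sort → List Sort
Stamped X = num ∷ num ∷ num ∷ X

-- The fixpoint of `iterate X base step` holds of (k, t₁, t₂, x̄) iff stage k of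
-- the iteration is complete and, in case t₁ = t₂, x̄ lies in the k-th iterate.
-- The tuples with t₁ ≠ t₂ mark completion: the inflationary fixpoint cannot
-- otherwise tell a tuple not yet decided from one decided false.  `base` defines
-- iterate 0; `step`, in which v₀ is the predecessor k₁ of k, defines iterate k
-- from iterate k₁, available as R(k₁, k₁, k₁, ·).
iterate-initial : ∀ {Γ Δ} X → Formula (Stamped X ++ Γ) (Stamped X ∷ Δ) → Formula (Stamped X ++ Γ) (Stamped X ∷ Δ)
iterate-initial X base = and (neg (ex num (succ (var v₀) (var v₁)))) (neg (eq (var v₁) (var v₂)) ∨ᶠ base)

iterate-step : ∀ {Γ Δ} X → Formula (num ∷ Stamped X ++ Γ) (Stamped X ∷ Δ) → Formula (num ∷ Stamped X ++ Γ) (Stamped X ∷ Δ)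
iterate-step X step =
  and (rel here (var v₀ ∷ var v₀ ∷ var v₁ ∷ varsOf X (λ v → there (there (there (there (weaken v)))))))
      (neg (eq (var v₂) (var v₃)) ∨ᶠ step)

iterate-successor : ∀ {Γ Δ} X → Formula (num ∷ Stamped X ++ Γ) (Stamped X ∷ Δ) → Formula (Stamped X ++ Γ) (Stamped X ∷ Δ)
iterate-successor X step = ex num (and (succ (var v₀) (var v₁)) (iterate-step X step))

iterate : ∀ {Γ Δ} X → Formula (Stamped X ++ Γ) (Stamped X ∷ Δ) → Formula (num ∷ Stamped X ++ Γ) (Stamped X ∷ Δ) →
          Formula (Stamped X ++ Γ) (Stamped X ∷ Δ)
iterate X base step = iterate-initial X base ∨ᶠ iterate-successor X step

maxNum : ∀ {Γ Δ} → Term Γ Δ num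
maxNum = count (eq (var v₀) (var v₀))

zeroNum : ∀ {Γ Δ} → Term Γ Δ num
zeroNum = count (neg (eq (var v₀) (var v₀)))

parity : ∀ {Γ Δ} → Formula (Stamped [] ++ Γ) (Stamped [] ∷ Δ)
parity = iterate [] (neg (eq (var v₀) (var v₀))) (neg (rel here (var v₀ ∷ var v₀ ∷ var v₀ ∷ [])))

Odd : ∀ {Γ Δ} → Term Γ Δ num → Formula Γ Δ
Odd t = ifp (Stamped []) parity (t ∷ t ∷ t ∷ [])

Pair : List Sort
Pair = vtx ∷ vtx ∷ []

-- In context k₁, k, t₁, t₂, w, v: #z (E(w, z) ∧ R(k₁, k₁, k₁, z, v)).
powerCount : ∀ {Γ Δ} → Term (num ∷ Stamped Pair ++ Γ) (Stamped Pair ∷ Δ) num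
powerCount = count (and (E (var v₅) (var v₀)) (rel here (var v₁ ∷ var v₁ ∷ var v₁ ∷ var v₀ ∷ var v₆ ∷ [])))

powerStep : ∀ {Γ Δ} → Formula (num ∷ Stamped Pair ++ Γ) (Stamped Pair ∷ Δ)
powerStep = Odd powerCount

Power : ∀ {Γ Δ} → Term Γ Δ num → Term Γ Δ vtx → Term Γ Δ vtx → Formula Γ Δ
Power j w v = ifp (Stamped Pair) (iterate Pair (eq (var v₃) (var v₄)) powerStep) (j ∷ j ∷ j ∷ w ∷ v ∷ [])

Entry : List Sort
Entry = vtx ∷ num ∷ []

-- The candidate formulas are evaluated inside the step of the row iteration,
-- extended by the row u in question: u, k₁, k, t₁, t₂, w, col, … .  There the
-- row iteration R is the second relation variable, its stage k₁ being the
-- current system.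
RowStepCtx : List Sort → List Sort
RowStepCtx Γ = vtx ∷ num ∷ Stamped Entry ++ Γ

entryᶠ : ∀ {Γ Δ} → RVar Δ (Stamped Entry) → Var Γ num → Var Γ vtx → Var Γ num → Formula Γ Δ
entryᶠ R k₁ x y = rel R (var k₁ ∷ var k₁ ∷ var k₁ ∷ var x ∷ var y ∷ [])

candidateᶠ : ∀ {Γ Δ} → Var Γ num → Var Γ vtx → Formula Γ (Stamped (vtx ∷ []) ∷ Δ)
candidateᶠ k₁ x = rel here (var k₁ ∷ var k₁ ∷ var k₁ ∷ var x ∷ [])

-- In context 0, t₁, t₂, u′, u, k₁, k, …: the rows with a 1 in column k, refined by column 0.
candidateBase : ∀ {Γ Δ} → Formula (Stamped (vtx ∷ []) ++ RowStepCtx Γ) (Stamped (vtx ∷ []) ∷ Stamped Entry ∷ Δ)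
candidateBase =
  refinementᶠ (entryᶠ (there here) v₅ v₃ v₆) (entryᶠ (there here) v₅ v₃ v₀) (entryᶠ (there here) v₆ v₀ v₇) (entryᶠ (there here) v₆ v₀ v₁)

-- In context j₁, j, t₁, t₂, u′, u, k₁, …: the candidates of stage j₁, refined by column j.
candidateStep : ∀ {Γ Δ} → Formula (num ∷ Stamped (vtx ∷ []) ++ RowStepCtx Γ) (Stamped (vtx ∷ []) ∷ Stamped Entry ∷ Δ)
candidateStep = refinementᶠ (candidateᶠ v₀ v₄) (entryᶠ (there here) v₆ v₄ v₁) (candidateᶠ v₁ v₀) (entryᶠ (there here) v₇ v₀ v₂)

Candidate : ∀ {Γ Δ} → Formula (RowStepCtx Γ) (Stamped Entry ∷ Δ)
Candidate = ifp (Stamped (vtx ∷ [])) (iterate (vtx ∷ []) candidateBase candidateStep) (maxNum ∷ maxNum ∷ maxNum ∷ var v₀ ∷ [])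

-- In context u, k₁, k, …, col, …: Candidate(u) ∧ R(u, col), R being stage k₁ of the row iteration.
pivotEntry : ∀ {Γ Δ} → Formula (RowStepCtx Γ) (Stamped Entry ∷ Δ)
pivotEntry = and Candidate (entryᶠ here v₁ v₀ v₆)

-- In context k₁, k, t₁, t₂, w, col, …: R(w, col) xor R(w, k) ∧ ∃u pivotEntry.
rowStep : ∀ {Γ Δ} → Formula (num ∷ Stamped Entry ++ Γ) (Stamped Entry ∷ Δ)
rowStep = entryᶠ here v₀ v₄ v₅ xorᶠ and (entryᶠ here v₀ v₄ v₁) (ex vtx pivotEntry)

rowIteration : ∀ {Γ Δ} → Var Γ vtx → Formula (Stamped Entry ++ Γ) (Stamped Entry ∷ Δ)
rowIteration v = iterate Entry (Power (var v₄) (var v₃) (var (there (there (there (there (there v))))))) rowStep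

-- In context w, v: entry (w, 0) of the eliminated Krylov system of v.
eliminatedEntry : Formula (vtx ∷ vtx ∷ []) []
eliminatedEntry = ifp (Stamped Entry) (rowIteration v₁) (maxNum ∷ maxNum ∷ maxNum ∷ var v₀ ∷ zeroNum ∷ [])

determinantSentence : Sentence
determinantSentence = neg (ex vtx (ex vtx eliminatedEntry))

-- Semantics of the sentence

anyEl-vtx : ∀ n (p : Fin n → Bool) → anyEl n vtx p ≡ or p
anyEl-vtx zero    p = refl
anyEl-vtx (suc m) p with p zero
... | b with suc m | p | p ∘ suc
...   | _ | _ | q with foldr-unique _∨_ false (λ b → b) {g = _} (λ _ → refl) (λ _ _ → refl) | m | q
...     | unique | k | f = cong (b ∨_) (unique k f)

anyEl-num : ∀ n (p : Fin (suc n) → Bool) → anyEl n num p ≡ or p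
anyEl-num zero    p = refl
anyEl-num (suc m) p with p zero | p (suc zero)
... | b₀ | b₁ with suc m | p | (λ (i : Fin m) → p (suc (suc i)))
...   | _ | _ | q with foldr-unique _∨_ false (λ b → b) {g = _} (λ _ → refl) (λ _ _ → refl) | m | q
...     | unique | k | f = cong (λ b → b₀ ∨ (b₁ ∨ b)) (unique k f)

not-∧-not : ∀ a b → not (not a ∧ not b) ≡ a ∨ b
not-∧-not false b = not-involutive b
not-∧-not true  b = refl

xor-as-∨ : ∀ a b → a ∧ not b ∨ not a ∧ b ≡ a xor b
xor-as-∨ false b = refl
xor-as-∨ true  b = ∨-identityʳ (not b)

∧-∨-absorb : ∀ b w → b ∧ w ∨ w ≡ w
∧-∨-absorb false w = refl
∧-∨-absorb true  w = ∨-idem w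

<ᵇ-false-suc : ∀ i s → (i <ᵇ s) ≡ false → (suc i <ᵇ s) ≡ false
<ᵇ-false-suc i       zero    _    = refl
<ᵇ-false-suc (suc i) (suc s) i≮s = <ᵇ-false-suc i s i≮s

isZero : Fin (suc n) → Bool
isZero zero    = true
isZero (suc _) = false

atPredecessor : Fin (suc n) → (Fin (suc n) → Bool) → Bool
atPredecessor zero    Q = false
atPredecessor (suc j) Q = Q (inject₁ j)

isSucc-suc : (a : Fin (suc n)) (j : Fin n) → isSucc n a (suc j) ≡ ⌊ a ≟ inject₁ j ⌋
isSucc-suc a j with a ≟ inject₁ j
... | yes _ = refl
... | no  _ = refl

or-isSucc : ∀ n (k : Fin (suc n)) (Q : Fin (suc n) → Bool) → or (λ a → isSucc n a k ∧ Q a) ≡ atPredecessor k Q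
or-isSucc n zero    Q = or-false {x = λ a → isSucc n a zero ∧ Q a} (λ _ → refl)
or-isSucc n (suc j) Q =
  trans (or-single _ (inject₁ j) (λ a a≢j → cong (_∧ Q a) (trans (isSucc-suc a j) (≟-false a≢j))))
        (cong (_∧ Q (inject₁ j)) (trans (isSucc-suc (inject₁ j) j) (≟-true refl)))

isSucc⇒clamp : ∀ {n} (a k : Fin (suc n)) → isSucc n a k ≡ true → k ≡ clamp (suc (toℕ a))
isSucc⇒clamp {suc n} a (suc j) a+1≡k with toWitness (Equivalence.from T-≡ (trans (sym (isSucc-suc a j)) a+1≡k))
... | refl = cong suc (trans (sym (clamp-toℕ j)) (cong clamp (sym (toℕ-inject₁ j))))

countFin-all : ∀ k (p : Fin k → Bool) → (∀ i → p i ≡ true) → countFin k p ≡ fromℕ k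
countFin-all zero    p _   = refl
countFin-all (suc k) p p≡1 rewrite p≡1 zero = cong suc (countFin-all k (p ∘ suc) (p≡1 ∘ suc))

countFin-none : ∀ k (p : Fin k → Bool) → (∀ i → p i ≡ false) → countFin k p ≡ zero
countFin-none zero    p _   = refl
countFin-none (suc k) p p≡0 rewrite p≡0 zero = cong inject₁ (countFin-none k (p ∘ suc) (p≡0 ∘ suc))

odd : ℕ → Bool
odd zero    = false
odd (suc m) = not (odd m)

odd-countFin : ∀ k (p : Fin k → Bool) → odd (toℕ (countFin k p)) ≡ sum p
odd-countFin zero    p = refl
odd-countFin (suc k) p with p zero
... | true  = cong not (odd-countFin k (p ∘ suc))
... | false = trans (cong odd (toℕ-inject₁ (countFin k (p ∘ suc)))) (odd-countFin k (p ∘ suc))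

natrec : {A : Set} → A → (ℕ → A → A) → ℕ → A
natrec z s zero    = z
natrec z s (suc m) = s m (natrec z s m)

size-nonZero : ∀ {n} X → .{{NonZero n}} → NonZero (size n X)
size-nonZero {n} []        = record { nonZero = tt }
size-nonZero {n} (vtx ∷ X) = m*n≢0 n (size n X) {{it}} {{size-nonZero X}}
size-nonZero {n} (num ∷ X) = m*n≢0 (suc n) (size n X) {{it}} {{size-nonZero X}}

refine-cong : {r r′ : Equations m n} {C C′ : Vector Bool m} → (∀ u col → r u col ≡ r′ u col) → (∀ u → C u ≡ C′ u) →
              ∀ col u → refine r C col u ≡ refine r′ C′ col u
refine-cong r≡r′ C≡C′ col u =
  cong₂ _∧_ (C≡C′ u) (cong₂ (λ a b → not a ∨ not b) (r≡r′ u col)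
                             (or-cong λ u′ → cong₂ (λ a b → a ∧ not b) (C≡C′ u′) (r≡r′ u′ col)))

candidates-cong : {r r′ : Equations m n} → (∀ u col → r u col ≡ r′ u col) → ∀ k t u → candidates r k t u ≡ candidates r′ k t u
candidates-cong r≡r′ k zero    = refine-cong r≡r′ (λ u → r≡r′ u k) zero
candidates-cong r≡r′ k (suc t) = refine-cong r≡r′ (candidates-cong r≡r′ k t) (clamp (suc t))

eliminate-cong : {r r′ : Equations m n} → (∀ u col → r u col ≡ r′ u col) → ∀ k w col → eliminate r k w col ≡ eliminate r′ k w col
eliminate-cong {n = n} r≡r′ k w col = cong₂ _xor_ (r≡r′ w col)
  (cong₂ _∧_ (r≡r′ w k) (or-cong λ u → cong₂ _∧_ (candidates-cong r≡r′ k n u) (r≡r′ u col)))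

module FormulaSemantics (n : ℕ) {{_ : NonZero n}} (G : Matrix n) where
  open Semantics n G

  eval-∨ᶠ : ∀ {Γ Δ} (φ ψ : Formula Γ Δ) ρ σ → eval (φ ∨ᶠ ψ) ρ σ ≡ eval φ ρ σ ∨ eval ψ ρ σ
  eval-∨ᶠ φ ψ ρ σ = not-∧-not (eval φ ρ σ) (eval ψ ρ σ)

  eval-xorᶠ : ∀ {Γ Δ} (φ ψ : Formula Γ Δ) ρ σ → eval (φ xorᶠ ψ) ρ σ ≡ eval φ ρ σ xor eval ψ ρ σ
  eval-xorᶠ φ ψ ρ σ =
    trans (not-∧-not (eval φ ρ σ ∧ not (eval ψ ρ σ)) (not (eval φ ρ σ) ∧ eval ψ ρ σ)) (xor-as-∨ (eval φ ρ σ) (eval ψ ρ σ))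

  eval-refinementᶠ : ∀ {Γ Δ} C Z C′ Z′ (ρ : Tup n Γ) (σ : REnv n Δ) → eval (refinementᶠ C Z C′ Z′) ρ σ ≡
                     eval C ρ σ ∧ (not (eval Z ρ σ) ∨ not (or λ x → eval C′ (x , ρ) σ ∧ not (eval Z′ (x , ρ) σ)))
  eval-refinementᶠ C Z C′ Z′ ρ σ = cong (eval C ρ σ ∧_) (trans (eval-∨ᶠ (neg Z) (neg (ex vtx (and C′ (neg Z′)))) ρ σ)
    (cong (λ b → not (eval Z ρ σ) ∨ not b) (anyEl-vtx n (λ x → eval C′ (x , ρ) σ ∧ not (eval Z′ (x , ρ) σ)))))

  lookup-weaken : ∀ {X Γ s} (x : Tup n X) (ρ : Tup n Γ) (v : Var X s) → lookupVar (appendTup n X Γ x ρ) (weaken v) ≡ lookupVar x v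
  lookup-weaken (a , x) ρ here      = refl
  lookup-weaken (a , x) ρ (there v) = lookup-weaken x ρ v

  evalTerms-varsOf : ∀ {Γ Δ} X (f : ∀ {s} → Var X s → Var Γ s) (ρ : Tup n Γ) (σ : REnv n Δ) (x : Tup n X) →
                     (∀ {s} (v : Var X s) → lookupVar ρ (f v) ≡ lookupVar x v) → evalTerms (varsOf X f) ρ σ ≡ x
  evalTerms-varsOf []      f ρ σ _       f≡x = refl
  evalTerms-varsOf (s ∷ X) f ρ σ (a , x) f≡x = cong₂ _,_ (f≡x here) (evalTerms-varsOf X (f ∘ there) ρ σ x (f≡x ∘ there))

  module Iteration {Γ Δ} (X : List Sort)
    (base : Formula (Stamped X ++ Γ) (Stamped X ∷ Δ)) (step : Formula (num ∷ Stamped X ++ Γ) (Stamped X ∷ Δ))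
    (ρ : Tup n Γ) (σ : REnv n Δ) (B : Tup n X → Bool) (St : ℕ → (Tup n X → Bool) → Tup n X → Bool)
    (eval-base : ∀ t₁ t₂ x R → eval base (zero , t₁ , t₂ , appendTup n X Γ x ρ) (R , σ) ≡ B x)
    (eval-step : ∀ k₁ k t₁ t₂ x R → isSucc n k₁ k ≡ true →
                 eval step (k₁ , k , t₁ , t₂ , appendTup n X Γ x ρ) (R , σ) ≡ St (toℕ k₁) (λ y → R (k₁ , k₁ , k₁ , y)) x)
    (St-cong : ∀ m P Q → (∀ y → P y ≡ Q y) → ∀ x → St m P x ≡ St m Q x) where

    value : ℕ → Tup n X → Bool
    value = natrec B St

    Env : Fin (suc n) → Fin (suc n) → Fin (suc n) → Tup n X → Tup n (Stamped X ++ Γ)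
    Env k t₁ t₂ x = k , t₁ , t₂ , appendTup n X Γ x ρ

    eval-iterate-body : ∀ k t₁ t₂ x R → eval (iterate X base step) (Env k t₁ t₂ x) (R , σ) ≡
      isZero k ∧ (not ⌊ t₁ ≟ t₂ ⌋ ∨ eval base (Env k t₁ t₂ x) (R , σ)) ∨
      atPredecessor k (λ k₁ → R (k₁ , k₁ , k , x) ∧ (not ⌊ t₁ ≟ t₂ ⌋ ∨ eval step (k₁ , Env k t₁ t₂ x) (R , σ)))
    eval-iterate-body k t₁ t₂ x R =
      trans (eval-∨ᶠ (iterate-initial X base) (iterate-successor X step) (Env k t₁ t₂ x) (R , σ)) (cong₂ _∨_ zeroCase succCase)
      where
      noPredecessor : ∀ k → not (atPredecessor k (λ _ → true)) ≡ isZero k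
      noPredecessor zero    = refl
      noPredecessor (suc _) = refl
      zeroCase : eval (iterate-initial X base) (Env k t₁ t₂ x) (R , σ) ≡ isZero k ∧ (not ⌊ t₁ ≟ t₂ ⌋ ∨ eval base (Env k t₁ t₂ x) (R , σ))
      zeroCase = cong₂ _∧_
        (trans (cong not (trans (anyEl-num n (λ k₁ → isSucc n k₁ k))
                                (trans (or-cong {x = λ a → isSucc n a k} (λ a → sym (∧-identityʳ _))) (or-isSucc n k (λ _ → true)))))
               (noPredecessor k))
        (eval-∨ᶠ (neg (eq (var v₁) (var v₂))) base (Env k t₁ t₂ x) (R , σ))
      Q : Fin (suc n) → Bool
      Q k₁ = R (k₁ , k₁ , k , x) ∧ (not ⌊ t₁ ≟ t₂ ⌋ ∨ eval step (k₁ , Env k t₁ t₂ x) (R , σ))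
      stamps : ∀ k₁ → evalTerms (varsOf X (λ v → there (there (there (there (weaken v)))))) (k₁ , Env k t₁ t₂ x) (R , σ) ≡ x
      stamps k₁ = evalTerms-varsOf X (λ v → there (there (there (there (weaken v))))) (k₁ , Env k t₁ t₂ x) (R , σ) x (lookup-weaken x ρ)
      body : Fin (suc n) → Bool
      body k₁ = eval (and (succ (var v₀) (var v₁)) (iterate-step X step)) (k₁ , Env k t₁ t₂ x) (R , σ)
      succCase : eval (iterate-successor X step) (Env k t₁ t₂ x) (R , σ) ≡ atPredecessor k Q
      succCase = begin
        anyEl n num body                             ≡⟨ anyEl-num n body ⟩
        or body                                      ≡⟨ or-cong {x = body} (λ k₁ → cong (isSucc n k₁ k ∧_) (cong₂ _∧_
                                                          (cong (λ y → R (k₁ , k₁ , k , y)) (stamps k₁))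
                                                          (eval-∨ᶠ (neg (eq (var v₂) (var v₃))) step (k₁ , Env k t₁ t₂ x) (R , σ)))) ⟩
        or (λ k₁ → isSucc n k₁ k ∧ Q k₁)             ≡⟨ or-isSucc n k Q ⟩
        atPredecessor k Q                            ∎
        where open ≡-Reasoning

    fixpoint : ℕ → Tup n (Stamped X) → Bool
    fixpoint = stage (Stamped X) (iterate X base step) ρ σ

    stage-iterate : ∀ s k t₁ t₂ x → fixpoint s (k , t₁ , t₂ , x) ≡ (toℕ k <ᵇ s) ∧ (not ⌊ t₁ ≟ t₂ ⌋ ∨ value (toℕ k) x)
    stage-iterate zero    k       t₁ t₂ x = refl
    stage-iterate (suc s) zero    t₁ t₂ x = begin
      fixpoint s (zero , t₁ , t₂ , x) ∨ eval (iterate X base step) (Env zero t₁ t₂ x) (fixpoint s , σ)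
        ≡⟨ cong₂ _∨_ (stage-iterate s zero t₁ t₂ x) (eval-iterate-body zero t₁ t₂ x (fixpoint s)) ⟩
      (0 <ᵇ s) ∧ W ∨ (not ⌊ t₁ ≟ t₂ ⌋ ∨ eval base (Env zero t₁ t₂ x) (fixpoint s , σ)) ∨ false
        ≡⟨ cong (λ b → (0 <ᵇ s) ∧ W ∨ (not ⌊ t₁ ≟ t₂ ⌋ ∨ b) ∨ false) (eval-base t₁ t₂ x (fixpoint s)) ⟩
      (0 <ᵇ s) ∧ W ∨ W ∨ false
        ≡⟨ cong ((0 <ᵇ s) ∧ W ∨_) (∨-identityʳ W) ⟩
      (0 <ᵇ s) ∧ W ∨ W
        ≡⟨ ∧-∨-absorb (0 <ᵇ s) W ⟩
      W ∎
      where
      open ≡-Reasoning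
      W = not ⌊ t₁ ≟ t₂ ⌋ ∨ B x
    stage-iterate (suc s) (suc j) t₁ t₂ x = begin
      fixpoint s (suc j , t₁ , t₂ , x) ∨ eval (iterate X base step) (Env (suc j) t₁ t₂ x) (fixpoint s , σ)
        ≡⟨ cong₂ _∨_ (stage-iterate s (suc j) t₁ t₂ x) (eval-iterate-body (suc j) t₁ t₂ x (fixpoint s)) ⟩
      (suc (toℕ j) <ᵇ s) ∧ W ∨
      fixpoint s (j′ , j′ , suc j , x) ∧ (not ⌊ t₁ ≟ t₂ ⌋ ∨ eval step (j′ , Env (suc j) t₁ t₂ x) (fixpoint s , σ))
        ≡⟨ cong₂ (λ b c → (suc (toℕ j) <ᵇ s) ∧ W ∨ b ∧ (not ⌊ t₁ ≟ t₂ ⌋ ∨ c)) previous-complete previous-step ⟩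
      (suc (toℕ j) <ᵇ s) ∧ W ∨ (toℕ j <ᵇ s) ∧ (not ⌊ t₁ ≟ t₂ ⌋ ∨ St (toℕ j) (λ y → (toℕ j <ᵇ s) ∧ value (toℕ j) y) x)
        ≡⟨ extend (toℕ j <ᵇ s) refl ⟩
      (toℕ j <ᵇ s) ∧ W ∎
      where
      open ≡-Reasoning
      j′ = inject₁ j
      W = not ⌊ t₁ ≟ t₂ ⌋ ∨ value (suc (toℕ j)) x
      previous-complete : fixpoint s (j′ , j′ , suc j , x) ≡ (toℕ j <ᵇ s)
      previous-complete = trans (stage-iterate s j′ j′ (suc j) x) (trans
        (cong₂ (λ a b → (a <ᵇ s) ∧ (not b ∨ value (toℕ j′) x)) (toℕ-inject₁ j)
               (≟-false (λ j′≡1+j → 1+n≢n (sym (trans (sym (toℕ-inject₁ j)) (cong toℕ j′≡1+j))))))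
        (∧-identityʳ _))
      previous-value : ∀ y → fixpoint s (j′ , j′ , j′ , y) ≡ (toℕ j <ᵇ s) ∧ value (toℕ j) y
      previous-value y = trans (stage-iterate s j′ j′ j′ y)
        (cong₂ (λ a b → (a <ᵇ s) ∧ (not b ∨ value a y)) (toℕ-inject₁ j) (≟-true refl))
      previous-step : eval step (j′ , Env (suc j) t₁ t₂ x) (fixpoint s , σ) ≡ St (toℕ j) (λ y → (toℕ j <ᵇ s) ∧ value (toℕ j) y) x
      previous-step = trans (eval-step j′ (suc j) t₁ t₂ x (fixpoint s) (trans (isSucc-suc j′ j) (≟-true refl)))
        (trans (cong (λ a → St a (λ y → fixpoint s (j′ , j′ , j′ , y)) x) (toℕ-inject₁ j)) (St-cong (toℕ j) _ _ previous-value x))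
      extend : ∀ b → (toℕ j <ᵇ s) ≡ b →
               (suc (toℕ j) <ᵇ s) ∧ W ∨ b ∧ (not ⌊ t₁ ≟ t₂ ⌋ ∨ St (toℕ j) (λ y → b ∧ value (toℕ j) y) x) ≡ b ∧ W
      extend true  _    = ∧-∨-absorb (suc (toℕ j) <ᵇ s) W
      extend false j≮s = trans (∨-identityʳ _) (cong (_∧ W) (<ᵇ-false-suc (toℕ j) s j≮s))

    eval-iterate : ∀ (ts : Terms Γ Δ (Stamped X)) k x → evalTerms ts ρ σ ≡ (k , k , k , x) →
                   eval (ifp (Stamped X) (iterate X base step) ts) ρ σ ≡ value (toℕ k) x
    eval-iterate ts k x ts≡kkkx = begin
      fixpoint (size n (Stamped X)) (evalTerms ts ρ σ)                                ≡⟨ cong (fixpoint (size n (Stamped X))) ts≡kkkx ⟩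
      fixpoint (size n (Stamped X)) (k , k , k , x)                                   ≡⟨ stage-iterate (size n (Stamped X)) k k k x ⟩
      (toℕ k <ᵇ size n (Stamped X)) ∧ (not ⌊ k ≟ k ⌋ ∨ value (toℕ k) x)
        ≡⟨ cong₂ (λ a b → a ∧ (not b ∨ value (toℕ k) x)) enoughStages (≟-true refl) ⟩
      value (toℕ k) x                                                                 ∎
      where
      open ≡-Reasoning
      enoughStages : (toℕ k <ᵇ size n (Stamped X)) ≡ true
      enoughStages = Equivalence.to T-≡ (<⇒<ᵇ (≤-trans (toℕ<n k)
        (m≤m*n (suc n) (size n (num ∷ num ∷ X)) {{size-nonZero (num ∷ num ∷ X)}})))

  odd-iteration : ∀ m → natrec (λ _ → false) (λ _ P _ → not (P tt)) m tt ≡ odd m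
  odd-iteration zero    = refl
  odd-iteration (suc m) = cong not (odd-iteration m)

  eval-Odd : ∀ {Γ Δ} (t : Term Γ Δ num) ρ σ → eval (Odd t) ρ σ ≡ odd (toℕ (evalTerm t ρ σ))
  eval-Odd t ρ σ = trans
    (Iteration.eval-iterate [] _ _ ρ σ (λ _ → false) (λ _ P _ → not (P tt))
       (λ _ _ _ _ → refl) (λ _ _ _ _ _ _ _ → refl) (λ _ _ _ P≡Q _ → cong not (P≡Q tt))
       (t ∷ t ∷ t ∷ []) (evalTerm t ρ σ) tt refl)
    (odd-iteration (toℕ (evalTerm t ρ σ)))

module GraphSemantics (n : ℕ) {{_ : NonZero n}} (G : Matrix n) where
  open Semantics n G
  open FormulaSemantics n G

  eval-Power : ∀ {Γ Δ} (j : Term Γ Δ num) (w v : Term Γ Δ vtx) ρ σ →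
               eval (Power j w v) ρ σ ≡ power G (toℕ (evalTerm j ρ σ)) (evalTerm w ρ σ) (evalTerm v ρ σ)
  eval-Power {Γ} {Δ} j w v ρ σ = trans
    (Iteration.eval-iterate Pair (eq (var v₃) (var v₄)) powerStep ρ σ B St (λ _ _ _ _ → refl) eval-step St-cong
       (j ∷ j ∷ j ∷ w ∷ v ∷ []) (evalTerm j ρ σ) (evalTerm w ρ σ , evalTerm v ρ σ , tt) refl)
    (value≡power (toℕ (evalTerm j ρ σ)) (evalTerm w ρ σ) (evalTerm v ρ σ))
    where
    B : Tup n Pair → Bool
    B (w , v , _) = identity w v
    St : ℕ → (Tup n Pair → Bool) → Tup n Pair → Bool
    St _ P (w , v , _) = (G *ᵥ λ z → P (z , v , tt)) w
    eval-step : ∀ k₁ k t₁ t₂ x R → isSucc n k₁ k ≡ true →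
                eval (powerStep {Γ} {Δ}) (k₁ , k , t₁ , t₂ , appendTup n Pair Γ x ρ) (R , σ) ≡ St (toℕ k₁) (λ y → R (k₁ , k₁ , k₁ , y)) x
    eval-step k₁ k t₁ t₂ (w , v , _) R _ =
      trans (eval-Odd (powerCount {Γ} {Δ}) (k₁ , k , t₁ , t₂ , w , v , ρ) (R , σ)) (odd-countFin n (λ z → G w z ∧ R (k₁ , k₁ , k₁ , z , v , tt)))
    St-cong : ∀ i P Q → (∀ y → P y ≡ Q y) → ∀ x → St i P x ≡ St i Q x
    St-cong _ P Q P≡Q (w , v , _) = *ᵥ-cong G (λ z → P≡Q (z , v , tt)) w
    value≡power : ∀ i w v → natrec B St i (w , v , tt) ≡ power G i w v
    value≡power zero    w v = refl
    value≡power (suc i) w v = *ᵥ-cong G (λ z → value≡power i z v) w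

  systemAt : (Tup n (Stamped Entry) → Bool) → Fin (suc n) → Equations n n
  systemAt R k₁ x y = R (k₁ , k₁ , k₁ , x , y , tt)

  eval-Candidate : ∀ {Γ Δ} (ρ : Tup n Γ) (σ : REnv n Δ) R u k₁ k t₁ t₂ w col →
                   eval (Candidate {Γ} {Δ}) (u , k₁ , k , t₁ , t₂ , w , col , ρ) (R , σ) ≡ candidates (systemAt R k₁) k n u
  eval-Candidate {Γ} {Δ} ρ σ R u k₁ k t₁ t₂ w col = begin
    eval Candidate ρ′ (R , σ)
      ≡⟨ Iteration.eval-iterate (vtx ∷ []) candidateBase candidateStep ρ′ (R , σ) B St eval-base eval-step St-cong
           (maxNum ∷ maxNum ∷ maxNum ∷ var v₀ ∷ []) (fromℕ n) (u , tt)
           (cong (λ top → top , top , top , u , tt) (countFin-all n (λ x → ⌊ x ≟ x ⌋) (λ x → ≟-true refl))) ⟩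
    natrec B St (toℕ (fromℕ n)) (u , tt) ≡⟨ cong (λ t → natrec B St t (u , tt)) (toℕ-fromℕ n) ⟩
    natrec B St n (u , tt)               ≡⟨ value≡candidates n u ⟩
    candidates system k n u              ∎
    where
    open ≡-Reasoning
    system : Equations n n
    system = systemAt R k₁
    ρ′ : Tup n (RowStepCtx Γ)
    ρ′ = u , k₁ , k , t₁ , t₂ , w , col , ρ
    B : Tup n (vtx ∷ []) → Bool
    B (u′ , _) = refine system (λ x → system x k) zero u′
    St : ℕ → (Tup n (vtx ∷ []) → Bool) → Tup n (vtx ∷ []) → Bool
    St i P (u′ , _) = refine system (λ x → P (x , tt)) (clamp (suc i)) u′
    eval-base : ∀ s₁ s₂ x R′ → eval (candidateBase {Γ} {Δ}) (zero , s₁ , s₂ , appendTup n (vtx ∷ []) (RowStepCtx Γ) x ρ′) (R′ , R , σ) ≡ B x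
    eval-base s₁ s₂ (u′ , _) R′ =
      eval-refinementᶠ {Stamped (vtx ∷ []) ++ RowStepCtx Γ} {Stamped (vtx ∷ []) ∷ Stamped Entry ∷ Δ}
        (entryᶠ (there here) v₅ v₃ v₆) (entryᶠ (there here) v₅ v₃ v₀) (entryᶠ (there here) v₆ v₀ v₇) (entryᶠ (there here) v₆ v₀ v₁)
        (zero , s₁ , s₂ , u′ , ρ′) (R′ , R , σ)
    eval-step : ∀ j₁ j s₁ s₂ x R′ → isSucc n j₁ j ≡ true →
                eval (candidateStep {Γ} {Δ}) (j₁ , j , s₁ , s₂ , appendTup n (vtx ∷ []) (RowStepCtx Γ) x ρ′) (R′ , R , σ) ≡
                St (toℕ j₁) (λ y → R′ (j₁ , j₁ , j₁ , y)) x
    eval-step j₁ j s₁ s₂ (u′ , _) R′ j₁+1≡j with isSucc⇒clamp j₁ j j₁+1≡j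
    ... | refl =
      eval-refinementᶠ {num ∷ Stamped (vtx ∷ []) ++ RowStepCtx Γ} {Stamped (vtx ∷ []) ∷ Stamped Entry ∷ Δ}
        (candidateᶠ v₀ v₄) (entryᶠ (there here) v₆ v₄ v₁) (candidateᶠ v₁ v₀) (entryᶠ (there here) v₇ v₀ v₂)
        (j₁ , j , s₁ , s₂ , u′ , ρ′) (R′ , R , σ)
    St-cong : ∀ i P Q → (∀ y → P y ≡ Q y) → ∀ x → St i P x ≡ St i Q x
    St-cong i P Q P≡Q (u′ , _) = refine-cong {r = system} (λ _ _ → refl) (λ x → P≡Q (x , tt)) (clamp (suc i)) u′
    value≡candidates : ∀ t u′ → natrec B St t (u′ , tt) ≡ candidates system k t u′
    value≡candidates zero    u′ = refl
    value≡candidates (suc t) u′ = refine-cong {r = system} (λ _ _ → refl) (λ x → value≡candidates t x) (clamp (suc t)) u′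

  eval-rowIteration : ∀ {Γ Δ} (v : Var Γ vtx) (ρ : Tup n Γ) (σ : REnv n Δ) (ts : Terms Γ Δ (Stamped Entry)) k w col →
                      evalTerms ts ρ σ ≡ (k , k , k , w , col , tt) →
                      eval (ifp (Stamped Entry) (rowIteration v) ts) ρ σ ≡ Elimination.reduced (krylovEquations G (lookupVar ρ v)) (toℕ k) w col
  eval-rowIteration {Γ} {Δ} v ρ σ ts k w col ts≡kkkx =
    trans (Iteration.eval-iterate Entry (Power (var v₄) (var v₃) (var (there (there (there (there (there v))))))) rowStep
             ρ σ B St eval-base eval-step St-cong ts k (w , col , tt) ts≡kkkx)
          (value≡reduced (toℕ k) w col)
    where
    B : Tup n Entry → Bool
    B (w , col , _) = krylovEquations G (lookupVar ρ v) w col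
    St : ℕ → (Tup n Entry → Bool) → Tup n Entry → Bool
    St i P (w , col , _) = eliminate (λ x y → P (x , y , tt)) (clamp (suc i)) w col
    eval-base : ∀ t₁ t₂ x R → eval (Power {Stamped Entry ++ Γ} {Stamped Entry ∷ Δ} (var v₄) (var v₃) (var (there (there (there (there (there v)))))))
                                   (zero , t₁ , t₂ , appendTup n Entry Γ x ρ) (R , σ) ≡ B x
    eval-base t₁ t₂ (w , col , _) R = eval-Power (var v₄) (var v₃) (var (there (there (there (there (there v)))))) (zero , t₁ , t₂ , w , col , ρ) (R , σ)
    eval-step : ∀ k₁ k t₁ t₂ x R → isSucc n k₁ k ≡ true →
                eval (rowStep {Γ} {Δ}) (k₁ , k , t₁ , t₂ , appendTup n Entry Γ x ρ) (R , σ) ≡ St (toℕ k₁) (λ y → R (k₁ , k₁ , k₁ , y)) x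
    eval-step k₁ k t₁ t₂ (w , col , _) R k₁+1≡k with isSucc⇒clamp k₁ k k₁+1≡k
    ... | refl = trans (eval-xorᶠ (entryᶠ here v₀ v₄ v₅) (and (entryᶠ here v₀ v₄ v₁) (ex vtx pivotEntry)) ρ′ (R , σ))
      (cong (λ b → systemAt R k₁ w col xor systemAt R k₁ w k ∧ b)
        (trans (anyEl-vtx n (λ u → eval pivotEntry (u , ρ′) (R , σ)))
               (or-cong λ u → cong (_∧ systemAt R k₁ u col) (eval-Candidate ρ σ R u k₁ k t₁ t₂ w col))))
      where
      ρ′ : Tup n (num ∷ Stamped Entry ++ Γ)
      ρ′ = k₁ , k , t₁ , t₂ , w , col , ρ
    St-cong : ∀ i P Q → (∀ y → P y ≡ Q y) → ∀ x → St i P x ≡ St i Q x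
    St-cong i P Q P≡Q (w , col , _) = eliminate-cong (λ x y → P≡Q (x , y , tt)) (clamp (suc i)) w col
    value≡reduced : ∀ i w col → natrec B St i (w , col , tt) ≡ Elimination.reduced (krylovEquations G (lookupVar ρ v)) i w col
    value≡reduced zero    w col = refl
    value≡reduced (suc i) w col = eliminate-cong (λ x y → value≡reduced i x y) (clamp (suc i)) w col

  eval-eliminatedEntry : ∀ w v → eval eliminatedEntry (w , v , tt) tt ≡ Elimination.reduced (krylovEquations G v) n w zero
  eval-eliminatedEntry w v = trans
    (eval-rowIteration v₁ (w , v , tt) tt (maxNum ∷ maxNum ∷ maxNum ∷ var v₀ ∷ zeroNum ∷ []) (fromℕ n) w zero
       (cong₂ (λ top z → top , top , top , w , z , tt) (countFin-all n (λ x → ⌊ x ≟ x ⌋) (λ _ → ≟-true refl))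
                                                        (countFin-none n (λ x → not ⌊ x ≟ x ⌋) (λ _ → cong not (≟-true refl)))))
    (cong (λ s → Elimination.reduced (krylovEquations G v) s w zero) (toℕ-fromℕ n))

  holds-determinantSentence : holds determinantSentence n G ≡ not (or λ v → or λ w → Elimination.reduced (krylovEquations G v) n w zero)
  holds-determinantSentence = cong not (trans (anyEl-vtx n (λ v → anyEl n vtx (λ w → entry v w)))
    (or-cong λ v → trans (anyEl-vtx n (entry v)) (or-cong λ w → eval-eliminatedEntry w v)))
    where
    entry : Fin n → Fin n → Bool
    entry v w = eval eliminatedEntry (w , v , tt) tt


  determinantSentence-correct : holds determinantSentence n G ≡ detZ2 n G
  determinantSentence-correct = ≡-via-⇔ sentence⇔cleared (det≡true⇔cleared n G)
    where
    cleared : Fin n → Fin n → Bool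
    cleared v w = Elimination.reduced (krylovEquations G v) n w zero
    sentence⇔cleared : holds determinantSentence n G ≡ true ⇔ (∀ v w → cleared v w ≡ false)
    sentence⇔cleared = subst (λ b → b ≡ true ⇔ (∀ v w → cleared v w ≡ false)) (sym holds-determinantSentence) (not-or-or≡true⇔ cleared)

mainTheorem8 : Σ Sentence (λ φ → (n : ℕ) (G : Fin n → Fin n → Bool) → holds φ n G ≡ detZ2 n G)
mainTheorem8 = determinantSentence , λ where
  zero    G → refl
  (suc m) G → GraphSemantics.determinantSentence-correct (suc m) G
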